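{- Let $H=(U,(A_1,\dots,A_m))$ be a harmonic set system with $|U|<m(m-2)$ and $m\ge 51$. Then $U$ can be partitioned as $U=U^{(1)}\sqcup U^{(2)}$ such that the induced set systems $H^{(j)}=(U^{(j)},(A_1\cap U^{(j)},\dots,A_m\cap U^{(j)}))$, $j=1,2$, are harmonic and satisfy, for every nonconsecutive $I\subseteq[m]$ with $|I|=3$, $\bigcap_{i\in I}(A_i\cap U^{(1)})=\varnothing$ and $\bigcap_{i\in I}(U^{(2)}\setminus A_i)=\varnothing$.
   Context: A set of integers is nonconsecutive if no two distinct elements differ by exactly $1$. For a set system $H=(U,(A_1,\dots,A_m))$ and $I\subseteq[m]$, $H_I=\bigcap_{i\in I}A_i$ ($=U$ if $I=\varnothing$). The run decomposition of a finite set $I$ of positive integers is the partition formed by the sizes, sorted nonincreasingly, of the maximal runs of consecutive integers in $I$. $H$ is harmonic if $|H_I|=|H_J|$ whenever $I,J\subseteq[m]$ have the same run decomposition. -}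

module Defs where

open import Data.Nat using (ℕ; zero; suc)
open import Data.Nat.Properties using (≤-decTotalOrder)
open import Data.Bool using (Bool; true; false; _∧_; _∨_; not)
open import Data.Fin using (Fin; zero; suc; toℕ)
open import Data.Fin.Subset using (Subset; _∈_; _∩_; _─_; ∣_∣; Empty; ∁)
open import Data.Vec using (Vec; lookup; tabulate; toList)
open import Data.List using (List; []; _∷_; reverse)
open import Data.Product using (_×_)
open import Relation.Binary.PropositionalEquality using (_≡_; _≢_)
import Data.List.Sort

-- Index i : Fin m represents the set A_{toℕ i + 1}; consecutiveness is
-- unaffected by this shift.

allFin : ∀ {m} → (Fin m → Bool) → Bool
allFin {zero}  f = true
allFin {suc m} f = f zero ∧ allFin (λ i → f (suc i))

-- Intersection W ∩ ⋂_{i ∈ I} B_i  (equal to W when I = ∅).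
interOn : ∀ {n m} → Subset n → (Fin m → Subset n) → Subset m → Subset n
interOn W B I =
  tabulate λ x → lookup W x ∧ allFin (λ i → not (lookup I i) ∨ lookup (B i) x)

-- Lengths of maximal runs of consecutive elements (the `true` blocks),
-- in order of occurrence; c is the length of the current run.
runsAux : ℕ → List Bool → List ℕ
runsAux zero    []            = []
runsAux (suc c) []            = suc c ∷ []
runsAux c       (true  ∷ bs)  = runsAux (suc c) bs
runsAux zero    (false ∷ bs)  = runsAux zero bs
runsAux (suc c) (false ∷ bs)  = suc c ∷ runsAux zero bs

runDecomposition : ∀ {m} → Subset m → List ℕ
runDecomposition I =
  reverse (Data.List.Sort.sort ≤-decTotalOrder (runsAux zero (toList I)))

HarmonicOn : ∀ {n m} → Subset n → (Fin m → Subset n) → Set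
HarmonicOn W B = ∀ I J → runDecomposition I ≡ runDecomposition J →
  ∣ interOn W B I ∣ ≡ ∣ interOn W B J ∣

Nonconsecutive : ∀ {m} → Subset m → Set
Nonconsecutive {m} I = ∀ (i j : Fin m) → i ∈ I → j ∈ I → toℕ j ≢ suc (toℕ i)

-- Identify a point x of U with its profile S x = {i : x ∈ A_i}, so that |H_I| counts the profiles
-- containing I, and take for U⁽¹⁾ the points whose profile contains no nonconsecutive triple.
--
-- Adding to I a nonconsecutive set at distance ≥ 2 from I only adds runs of length 1, so by
-- harmonicity the number of profiles containing I ∪ Y, for Y inside such a set X, depends only on
-- the run decomposition of I and on |Y|; by inclusion–exclusion the same holds for the number of
-- profiles containing I with any prescribed kind of trace on X.
--
-- If some S x and its complement both contained nonconsecutive triples, then (m ≥ 29) a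
-- nonconsecutive sextet would meet S x in exactly three points; transferring this to the first six
-- points of the alternating set E = {1, 3, 5, …} yields a profile meeting E in k ≥ 3 points and
-- missing r ≥ 3 of them, and then every trace on E of weight k occurs, so
-- |U| ≥ C(k + r, k) ≥ C(⌈m/2⌉, 3) ≥ m(m − 2).  Hence, for a nonconsecutive quintet X far from I,
-- x ∈ U⁽¹⁾ exactly when |S x ∩ X| ≤ 2, which makes the count over U⁽¹⁾ harmonic (it vanishes when
-- |I| ≥ 6); the count over U⁽²⁾ is the difference.

module Submission where

open import Defs
open import Data.Nat using (ℕ; zero; suc; _+_; _*_; _∸_; _≤_; _<_; z≤n; s≤s; _≤?_; _<ᵇ_; _≡ᵇ_)
import Data.Nat as ℕ
open import Data.Nat.Properties
open import Data.Nat.ListAction using (sum)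
open import Data.Nat.ListAction.Properties using (sum-↭)
open import Data.Nat.Tactic.RingSolver using (solve-∀)
open import Data.Bool.Base using (Bool; true; false; not; _∧_; _∨_)
import Data.Bool as Bool
open import Data.Bool.ListAction using (all)
open import Data.Bool.Properties
  using (∧-conicalˡ; ∧-conicalʳ; ∧-identityʳ; ∧-zeroʳ; ∧-comm; ∨-identityʳ; ∨-zeroʳ)
open import Data.Bool.Properties using (not-injective; not-involutive; T-≡)
open import Data.Empty using (⊥)
open import Data.Unit.Base using (tt) renaming (⊤ to Unit)
open import Data.Fin using (Fin; zero; suc)
open import Data.Fin.Properties using () renaming (suc-injective to Fin-suc-injective)
open import Data.Fin.Subset using (Subset; ⊤; ∁; _∩_; _∪_; _─_; ∣_∣; Empty; ⁅_⁆) renaming (⊥ to ∅)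
open import Data.Fin.Subset.Properties using (∣p∣≤n; ∣∁p∣≡n∸∣p∣; ∣⊥∣≡0; ∪-assoc; ∪-identityˡ; ∪-identityʳ; anySubset?)
open import Data.Vec using ([]; _∷_; lookup; tabulate; toList; here; there)
open import Data.Vec.Properties
  using (lookup∘tabulate; lookup-map; lookup-zipWith; lookup-replicate; tabulate-cong; tabulate-∘; []=⇒lookup)
import Data.Vec.Properties as Vecₚ
open import Data.List using (List; []; _∷_; _++_; length; replicate; reverse)
import Data.List as List
open import Data.List.Properties using (length-map; length-replicate; reverse-injective; ∷-injectiveˡ; ∷-injectiveʳ)
import Data.List.Properties as Listₚ
open import Data.List.Relation.Binary.Permutation.Propositional
  using (_↭_; ↭-refl; ↭-sym; ↭-trans; ↭⇒↭ₛ; prep; module PermutationReasoning)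
open import Data.List.Relation.Binary.Permutation.Propositional.Properties using (++⁺ʳ; shift)
open import Data.List.Relation.Binary.Pointwise using (Pointwise-≡⇒≡)
open import Data.List.Relation.Unary.All as All using (All; []; _∷_)
import Data.List.Relation.Unary.All.Properties as Allₚ
open import Data.List.Relation.Unary.Sorted.TotalOrder.Properties using (↗↭↗⇒≋)
open import Data.List.Relation.Unary.Unique.Propositional using (Unique; []; _∷_)
import Data.List.Relation.Unary.Unique.Propositional.Properties as Uniqueₚ
import Data.List.Sort
open import Data.Product using (∃; Σ; _×_; _,_; proj₁; proj₂)
open import Function.Bundles using (Equivalence)
open import Relation.Nullary using (¬_; Dec; yes; no; does; _×-dec_; ¬?; contradiction)
open import Relation.Nullary.Decidable using (dec-true; dec-false)
open import Relation.Binary.PropositionalEquality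

-- Subsets as Boolean vectors

infix 5 _⊆ᵇ_

_⊆ᵇ_ : ∀ {k} → Subset k → Subset k → Bool
[]      ⊆ᵇ []      = true
(i ∷ I) ⊆ᵇ (s ∷ S) = (not i ∨ s) ∧ (I ⊆ᵇ S)

∧-intro : ∀ {a b} → a ≡ true → b ≡ true → a ∧ b ≡ true
∧-intro refl refl = refl

⊆ᵇ-trans : ∀ {k} (X Y Z : Subset k) → X ⊆ᵇ Y ≡ true → Y ⊆ᵇ Z ≡ true → X ⊆ᵇ Z ≡ true
⊆ᵇ-trans []          []          []          _   _   = refl
⊆ᵇ-trans (false ∷ X) (y ∷ Y)     (z ∷ Z)     X⊆Y Y⊆Z = ⊆ᵇ-trans X Y Z X⊆Y (∧-conicalʳ _ _ Y⊆Z)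
⊆ᵇ-trans (true ∷ X)  (true ∷ Y)  (true ∷ Z)  X⊆Y Y⊆Z = ⊆ᵇ-trans X Y Z X⊆Y Y⊆Z

∅⊆ᵇ : ∀ {k} (Y : Subset k) → ∅ ⊆ᵇ Y ≡ true
∅⊆ᵇ []      = refl
∅⊆ᵇ (y ∷ Y) = ∅⊆ᵇ Y

∩⊆ᵇˡ : ∀ {k} (s X : Subset k) → s ∩ X ⊆ᵇ s ≡ true
∩⊆ᵇˡ []          []          = refl
∩⊆ᵇˡ (false ∷ s) (x ∷ X)     = ∩⊆ᵇˡ s X
∩⊆ᵇˡ (true ∷ s)  (true ∷ X)  = ∩⊆ᵇˡ s X
∩⊆ᵇˡ (true ∷ s)  (false ∷ X) = ∩⊆ᵇˡ s X

∩⊆ᵇʳ : ∀ {k} (s X : Subset k) → s ∩ X ⊆ᵇ X ≡ true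
∩⊆ᵇʳ []          []          = refl
∩⊆ᵇʳ (false ∷ s) (x ∷ X)     = ∩⊆ᵇʳ s X
∩⊆ᵇʳ (true ∷ s)  (true ∷ X)  = ∩⊆ᵇʳ s X
∩⊆ᵇʳ (true ∷ s)  (false ∷ X) = ∩⊆ᵇʳ s X

∩-monoʳ-⊆ᵇ : ∀ {k} (s X Y : Subset k) → X ⊆ᵇ Y ≡ true → s ∩ X ⊆ᵇ s ∩ Y ≡ true
∩-monoʳ-⊆ᵇ []          []          []          _   = refl
∩-monoʳ-⊆ᵇ (false ∷ s) (x ∷ X)     (y ∷ Y)     X⊆Y = ∩-monoʳ-⊆ᵇ s X Y (∧-conicalʳ _ _ X⊆Y)
∩-monoʳ-⊆ᵇ (true ∷ s)  (false ∷ X) (y ∷ Y)     X⊆Y = ∩-monoʳ-⊆ᵇ s X Y (∧-conicalʳ _ _ X⊆Y)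
∩-monoʳ-⊆ᵇ (true ∷ s)  (true ∷ X)  (true ∷ Y)  X⊆Y = ∩-monoʳ-⊆ᵇ s X Y X⊆Y

∣∣-mono-⊆ᵇ : ∀ {k} (X Y : Subset k) → X ⊆ᵇ Y ≡ true → ∣ X ∣ ≤ ∣ Y ∣
∣∣-mono-⊆ᵇ []          []          _   = z≤n
∣∣-mono-⊆ᵇ (false ∷ X) (false ∷ Y) X⊆Y = ∣∣-mono-⊆ᵇ X Y X⊆Y
∣∣-mono-⊆ᵇ (false ∷ X) (true ∷ Y)  X⊆Y = m≤n⇒m≤1+n (∣∣-mono-⊆ᵇ X Y X⊆Y)
∣∣-mono-⊆ᵇ (true ∷ X)  (true ∷ Y)  X⊆Y = s≤s (∣∣-mono-⊆ᵇ X Y X⊆Y)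

∪-⊆ᵇ : ∀ {k} (X Y s : Subset k) → X ∪ Y ⊆ᵇ s ≡ (X ⊆ᵇ s) ∧ (Y ⊆ᵇ s)
∪-⊆ᵇ []          []          []          = refl
∪-⊆ᵇ (true ∷ X)  (true ∷ Y)  (true ∷ s)  = ∪-⊆ᵇ X Y s
∪-⊆ᵇ (true ∷ X)  (false ∷ Y) (true ∷ s)  = ∪-⊆ᵇ X Y s
∪-⊆ᵇ (true ∷ X)  (y ∷ Y)     (false ∷ s) = refl
∪-⊆ᵇ (false ∷ X) (true ∷ Y)  (true ∷ s)  = ∪-⊆ᵇ X Y s
∪-⊆ᵇ (false ∷ X) (true ∷ Y)  (false ∷ s) = sym (∧-zeroʳ (X ⊆ᵇ s))
∪-⊆ᵇ (false ∷ X) (false ∷ Y) (b ∷ s)     = ∪-⊆ᵇ X Y s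

⁅⁆-⊆ᵇ : ∀ {k} (q : Fin k) (s : Subset k) → ⁅ q ⁆ ⊆ᵇ s ≡ lookup s q
⁅⁆-⊆ᵇ zero    (b ∷ s) = trans (cong ((not true ∨ b) ∧_) (∅⊆ᵇ s)) (∧-identityʳ b)
⁅⁆-⊆ᵇ (suc q) (b ∷ s) = ⁅⁆-⊆ᵇ q s

∣∣-split : ∀ {k} (s X : Subset k) → ∣ X ∣ ≡ ∣ s ∩ X ∣ + ∣ ∁ s ∩ X ∣
∣∣-split []          []          = refl
∣∣-split (true ∷ s)  (true ∷ X)  = cong suc (∣∣-split s X)
∣∣-split (false ∷ s) (true ∷ X)  = trans (cong suc (∣∣-split s X)) (sym (+-suc _ _))
∣∣-split (b ∷ s)     (false ∷ X) rewrite ∧-zeroʳ b | ∧-zeroʳ (not b) = ∣∣-split s X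

∩-∪-separated : ∀ {k} (s A B : Subset k) → A ⊆ᵇ s ≡ true → B ⊆ᵇ ∁ s ≡ true →
  s ∩ (A ∪ B) ≡ A × ∁ s ∩ (A ∪ B) ≡ B
∩-∪-separated []          []          []          _    _    = refl , refl
∩-∪-separated (true ∷ s)  (a ∷ A)     (false ∷ B) A⊆s  B⊆∁s with ∩-∪-separated s A B (∧-conicalʳ _ _ A⊆s) B⊆∁s
... | eqˢ , eqᶜ = cong₂ _∷_ (∨-identityʳ a) eqˢ , cong (false ∷_) eqᶜ
∩-∪-separated (false ∷ s) (false ∷ A) (b ∷ B)     A⊆s  B⊆∁s with ∩-∪-separated s A B A⊆s (∧-conicalʳ _ _ B⊆∁s)
... | eqˢ , eqᶜ = cong (false ∷_) eqˢ , cong (b ∷_) eqᶜ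

∁-involutive : ∀ {k} (s : Subset k) → ∁ (∁ s) ≡ s
∁-involutive s = trans (sym (Vecₚ.map-∘ not not s)) (trans (Vecₚ.map-cong not-involutive s) (Vecₚ.map-id s))

count : ∀ {n} → (Fin n → Bool) → ℕ
count g = ∣ tabulate g ∣

count-cong : ∀ {n} {g h : Fin n → Bool} → (∀ x → g x ≡ h x) → count g ≡ count h
count-cong g≗h = cong ∣_∣ (tabulate-cong g≗h)

count-split : ∀ {n} (h g : Fin n → Bool) →
  count g ≡ count (λ x → h x ∧ g x) + count (λ x → not (h x) ∧ g x)
count-split {zero}  h g = refl
count-split {suc n} h g with h zero | g zero | count-split (λ x → h (suc x)) (λ x → g (suc x))
... | true  | true  | split = cong suc split
... | true  | false | split = split
... | false | true  | split = trans (cong suc split) (sym (+-suc _ _))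
... | false | false | split = split

count≤n : ∀ {n} (g : Fin n → Bool) → count g ≤ n
count≤n g = ∣p∣≤n (tabulate g)

count-zero : ∀ {n} (g : Fin n → Bool) → (∀ x → g x ≡ false) → count g ≡ 0
count-zero {zero}  g g≡false = refl
count-zero {suc n} g g≡false rewrite g≡false zero = count-zero (λ x → g (suc x)) (λ x → g≡false (suc x))

count-positive : ∀ {n} (g : Fin n → Bool) x → g x ≡ true → 1 ≤ count g
count-positive g zero    gx rewrite gx = s≤s z≤n
count-positive g (suc x) gx with g zero
... | true  = s≤s z≤n
... | false = count-positive (λ y → g (suc y)) x gx

count-witness : ∀ {n} (g : Fin n → Bool) → 1 ≤ count g → ∃ λ x → g x ≡ true
count-witness {suc n} g pos with g zero in g0
... | true  = zero , g0
... | false with count-witness (λ y → g (suc y)) pos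
...   | x , gx = suc x , gx

-- Runs

open Data.List.Sort ≤-decTotalOrder using (sort; sort-↭; sort-↗)

runs : ∀ {k} → Subset k → List ℕ
runs I = runsAux zero (toList I)

↭⇒runDecomposition≡ : ∀ {k} (I J : Subset k) → runs I ↭ runs J → runDecomposition I ≡ runDecomposition J
↭⇒runDecomposition≡ I J I↭J = cong reverse (Pointwise-≡⇒≡ (↗↭↗⇒≋ ≤-totalOrder (sort-↗ (runs I)) (sort-↗ (runs J))
  (↭⇒↭ₛ (↭-trans (sort-↭ (runs I)) (↭-trans I↭J (↭-sym (sort-↭ (runs J))))))))

runDecomposition≡⇒↭ : ∀ {k} (I J : Subset k) → runDecomposition I ≡ runDecomposition J → runs I ↭ runs J
runDecomposition≡⇒↭ I J I≡J =
  ↭-trans (↭-sym (sort-↭ (runs I))) (↭-trans (≡⇒↭ (reverse-injective I≡J)) (sort-↭ (runs J)))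
  where
  ≡⇒↭ : ∀ {xs ys : List ℕ} → xs ≡ ys → xs ↭ ys
  ≡⇒↭ refl = ↭-refl

sum-runsAux : ∀ {k} c (I : Subset k) → sum (runsAux c (toList I)) ≡ c + ∣ I ∣
sum-runsAux zero    []          = refl
sum-runsAux (suc c) []          = refl
sum-runsAux zero    (true ∷ I)  = sum-runsAux 1 I
sum-runsAux (suc c) (true ∷ I)  = trans (sum-runsAux (suc (suc c)) I) (sym (+-suc (suc c) ∣ I ∣))
sum-runsAux zero    (false ∷ I) = sum-runsAux zero I
sum-runsAux (suc c) (false ∷ I) = cong (suc c +_) (sum-runsAux zero I)

runDecomposition≡⇒∣∣≡ : ∀ {k} (I J : Subset k) → runDecomposition I ≡ runDecomposition J → ∣ I ∣ ≡ ∣ J ∣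
runDecomposition≡⇒∣∣≡ I J I≡J = begin
  ∣ I ∣               ≡⟨ sum-runsAux zero I ⟨
  sum (runs I)        ≡⟨ sum-↭ (runDecomposition≡⇒↭ I J I≡J) ⟩
  sum (runs J)        ≡⟨ sum-runsAux zero J ⟩
  ∣ J ∣               ∎
  where open ≡-Reasoning

-- Nonconsecutive sets

startsInside : ∀ {k} → Subset k → Bool
startsInside []      = false
startsInside (b ∷ _) = b

-- In the `…After` variants the flag tells whether the position just before the vector is occupied.
nonconsecutiveAfter : ∀ {k} → Bool → Subset k → Bool
nonconsecutiveAfter p []      = true
nonconsecutiveAfter p (x ∷ X) = not (p ∧ x) ∧ nonconsecutiveAfter x X

nonconsecutive : ∀ {k} → Subset k → Bool
nonconsecutive = nonconsecutiveAfter false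

-- `farFrom I` consists of the positions that neither lie in I nor are adjacent to an element of I.
farFromAfter : ∀ {k} → Bool → Subset k → Subset k
farFromAfter p []      = []
farFromAfter p (i ∷ I) = not (p ∨ i ∨ startsInside I) ∷ farFromAfter i I

farFrom : ∀ {k} → Subset k → Subset k
farFrom = farFromAfter false

-- Invariant for scanning I ∪ X: no element of X lies in I or next to an element of I ∪ X.
-- The flags say whether the previous position lies in I ∪ X, resp. in X.
Apart : ∀ {k} → Bool → Bool → Subset k → Subset k → Set
Apart occ inX []      []      = Unit
Apart occ inX (i ∷ I) (x ∷ X) =
  (x ≡ true → occ ≡ false × i ≡ false) × (inX ≡ true → i ≡ false × x ≡ false) × Apart (i ∨ x) x I X

far⇒Apart : ∀ {k} pI pX (I X : Subset k) → X ⊆ᵇ farFromAfter pI I ≡ true → nonconsecutiveAfter pX X ≡ true →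
  (pX ≡ true → startsInside I ≡ false) → Apart (pI ∨ pX) pX I X
far⇒Apart pI    pX    []          []          _   _  _    = tt
far⇒Apart pI    false (i ∷ I)     (false ∷ X) X⊆ nc _    = (λ ()) , (λ ()) , far⇒Apart i false I X X⊆ nc (λ ())
far⇒Apart pI    true  (i ∷ I)     (false ∷ X) X⊆ nc hd   =
  (λ ()) , (λ p → hd p , refl) , far⇒Apart i false I X X⊆ nc (λ ())
far⇒Apart false false (false ∷ I) (true ∷ X)  X⊆ nc _    =
  (λ _ → refl , refl) , (λ ()) , far⇒Apart false true I X (∧-conicalʳ _ _ X⊆) nc (λ _ → not-injective (∧-conicalˡ _ _ X⊆))
far⇒Apart true  pX    (i ∷ I)     (true ∷ X)  ()  nc _
far⇒Apart false pX    (true ∷ I)  (true ∷ X)  ()  nc _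
far⇒Apart false true  (false ∷ I) (true ∷ X)  X⊆ () _

runsAux-∪-Apart : ∀ {k} c (I X : Subset k) → Apart (0 <ᵇ c) false I X →
  runsAux c (toList (I ∪ X)) ↭ runsAux c (toList I) ++ replicate ∣ X ∣ 1
runsAux-∪-Apart zero    []          []          _               = ↭-refl
runsAux-∪-Apart (suc c) []          []          _               = ↭-refl
runsAux-∪-Apart zero    (false ∷ I) (false ∷ X) (_ , _ , apart) = runsAux-∪-Apart zero I X apart
runsAux-∪-Apart (suc c) (false ∷ I) (false ∷ X) (_ , _ , apart) = prep (suc c) (runsAux-∪-Apart zero I X apart)
runsAux-∪-Apart zero    (true ∷ I)  (false ∷ X) (_ , _ , apart) = runsAux-∪-Apart 1 I X apart
runsAux-∪-Apart (suc c) (true ∷ I)  (false ∷ X) (_ , _ , apart) = runsAux-∪-Apart (suc (suc c)) I X apart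
runsAux-∪-Apart c       (true ∷ I)  (true ∷ X)  (isolated , _)  with () ← proj₂ (isolated refl)
runsAux-∪-Apart (suc c) (false ∷ I) (true ∷ X)  (isolated , _)  with () ← proj₁ (isolated refl)
runsAux-∪-Apart zero    (false ∷ I) (true ∷ X)  (_ , _ , apart) = singleton I X apart
  where
  singleton : ∀ {k} (I X : Subset k) → Apart true true I X →
    runsAux 1 (toList (I ∪ X)) ↭ runsAux 0 (toList I) ++ 1 ∷ replicate ∣ X ∣ 1
  singleton []          []          _               = ↭-refl
  singleton (false ∷ I) (false ∷ X) (_ , _ , apart) =
    ↭-trans (prep 1 (runsAux-∪-Apart zero I X apart)) (↭-sym (shift 1 (runsAux 0 (toList I)) _))
  singleton (true ∷ I)  (x ∷ X)     (_ , next , _)  with () ← proj₁ (next refl)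
  singleton (false ∷ I) (true ∷ X)  (_ , next , _)  with () ← proj₂ (next refl)

runs-∪-far : ∀ {k} (I X : Subset k) → nonconsecutive X ≡ true → X ⊆ᵇ farFrom I ≡ true →
  runs (I ∪ X) ↭ runs I ++ replicate ∣ X ∣ 1
runs-∪-far I X nc far = runsAux-∪-Apart zero I X (far⇒Apart false false I X far nc (λ ()))

runDecomposition-∪-far : ∀ {k} (I J X Y : Subset k) → runDecomposition I ≡ runDecomposition J →
  nonconsecutive X ≡ true → X ⊆ᵇ farFrom I ≡ true → nonconsecutive Y ≡ true → Y ⊆ᵇ farFrom J ≡ true →
  ∣ X ∣ ≡ ∣ Y ∣ → runDecomposition (I ∪ X) ≡ runDecomposition (J ∪ Y)
runDecomposition-∪-far I J X Y I≈J ncX farX ncY farY ∣X∣≡∣Y∣ = ↭⇒runDecomposition≡ (I ∪ X) (J ∪ Y) (begin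
  runs (I ∪ X)                 ↭⟨ runs-∪-far I X ncX farX ⟩
  runs I ++ replicate (∣ X ∣) 1  ↭⟨ ++⁺ʳ _ (runDecomposition≡⇒↭ I J I≈J) ⟩
  runs J ++ replicate (∣ X ∣) 1  ≡⟨ cong (λ j → runs J ++ replicate j 1) ∣X∣≡∣Y∣ ⟩
  runs J ++ replicate (∣ Y ∣) 1  ↭⟨ runs-∪-far J Y ncY farY ⟨
  runs (J ∪ Y)                 ∎)
  where open PermutationReasoning

nonconsecutiveAfter-⊆ᵇ : ∀ {k} pY pX (Y X : Subset k) → Y ⊆ᵇ X ≡ true → nonconsecutiveAfter pX X ≡ true →
  (pY ≡ true → pX ≡ true) → nonconsecutiveAfter pY Y ≡ true
nonconsecutiveAfter-⊆ᵇ pY    pX []          []          _   _  _  = refl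
nonconsecutiveAfter-⊆ᵇ false pX (false ∷ Y) (x ∷ X)     Y⊆X nc _  =
  nonconsecutiveAfter-⊆ᵇ false x Y X Y⊆X (∧-conicalʳ _ _ nc) (λ ())
nonconsecutiveAfter-⊆ᵇ true  pX (false ∷ Y) (x ∷ X)     Y⊆X nc _  =
  nonconsecutiveAfter-⊆ᵇ false x Y X Y⊆X (∧-conicalʳ _ _ nc) (λ ())
nonconsecutiveAfter-⊆ᵇ false pX (true ∷ Y)  (true ∷ X)  Y⊆X nc _  =
  nonconsecutiveAfter-⊆ᵇ true true Y X Y⊆X (∧-conicalʳ _ _ nc) (λ _ → refl)
nonconsecutiveAfter-⊆ᵇ true  pX (true ∷ Y)  (true ∷ X)  Y⊆X nc pY⇒pX with pY⇒pX refl
nonconsecutiveAfter-⊆ᵇ true  .true (true ∷ Y) (true ∷ X) Y⊆X () pY⇒pX | refl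

nonconsecutive-⊆ᵇ : ∀ {k} (Y X : Subset k) → Y ⊆ᵇ X ≡ true → nonconsecutive X ≡ true → nonconsecutive Y ≡ true
nonconsecutive-⊆ᵇ Y X Y⊆X nc = nonconsecutiveAfter-⊆ᵇ false false Y X Y⊆X nc (λ ())

nonconsecutiveAfter-∪-Apart : ∀ {k} pA pB (A B : Subset k) → Apart (pA ∨ pB) pB A B →
  nonconsecutiveAfter pA A ≡ true → nonconsecutiveAfter pB B ≡ true → nonconsecutiveAfter (pA ∨ pB) (A ∪ B) ≡ true
nonconsecutiveAfter-∪-Apart pA    pB    []          []          _ _ _ = refl
nonconsecutiveAfter-∪-Apart pA    pB    (true ∷ A)  (true ∷ B)  (isolated , _) _ _ with () ← proj₂ (isolated refl)
nonconsecutiveAfter-∪-Apart true  pB    (true ∷ A)  (false ∷ B) _ () _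
nonconsecutiveAfter-∪-Apart false true  (true ∷ A)  (false ∷ B) (_ , next , _) _ _ with () ← proj₁ (next refl)
nonconsecutiveAfter-∪-Apart false false (true ∷ A)  (false ∷ B) (_ , _ , apart) ncA ncB =
  nonconsecutiveAfter-∪-Apart true false A B apart ncA ncB
nonconsecutiveAfter-∪-Apart true  pB    (false ∷ A) (true ∷ B)  (isolated , _) _ _ with () ← proj₁ (isolated refl)
nonconsecutiveAfter-∪-Apart false true  (false ∷ A) (true ∷ B)  (isolated , _) _ _ with () ← proj₁ (isolated refl)
nonconsecutiveAfter-∪-Apart false false (false ∷ A) (true ∷ B)  (_ , _ , apart) ncA ncB =
  nonconsecutiveAfter-∪-Apart false true A B apart ncA ncB
nonconsecutiveAfter-∪-Apart pA    pB    (false ∷ A) (false ∷ B) (_ , _ , apart) ncA ncB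
  rewrite ∧-zeroʳ pA | ∧-zeroʳ pB | ∧-zeroʳ (pA ∨ pB) = nonconsecutiveAfter-∪-Apart false false A B apart ncA ncB

nonconsecutive-∪-far : ∀ {k} (A B : Subset k) → nonconsecutive A ≡ true → nonconsecutive B ≡ true →
  B ⊆ᵇ farFrom A ≡ true → nonconsecutive (A ∪ B) ≡ true
nonconsecutive-∪-far A B ncA ncB far =
  nonconsecutiveAfter-∪-Apart false false A B (far⇒Apart false false A B far ncB (λ ())) ncA ncB

⊆ᵇ-farFrom-∅ : ∀ {k} (X : Subset k) → X ⊆ᵇ farFrom ∅ ≡ true
⊆ᵇ-farFrom-∅ []           = refl
⊆ᵇ-farFrom-∅ (x ∷ [])     = ∧-intro (∨-zeroʳ (not x)) refl
⊆ᵇ-farFrom-∅ (x ∷ y ∷ X)  = ∧-intro (∨-zeroʳ (not x)) (⊆ᵇ-farFrom-∅ (y ∷ X))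

NonconsecutiveSubset : ∀ {k} → ℕ → Subset k → Set
NonconsecutiveSubset {k} j Y = Σ (Subset k) λ T → T ⊆ᵇ Y ≡ true × nonconsecutive T ≡ true × ∣ T ∣ ≡ j

takeFirst : ∀ {k} → ℕ → Subset k → Subset k
takeFirst j       []          = []
takeFirst zero    (b ∷ Y)     = false ∷ takeFirst zero Y
takeFirst (suc j) (false ∷ Y) = false ∷ takeFirst (suc j) Y
takeFirst (suc j) (true ∷ Y)  = true ∷ takeFirst j Y

takeFirst-⊆ᵇ : ∀ {k} j (Y : Subset k) → takeFirst j Y ⊆ᵇ Y ≡ true
takeFirst-⊆ᵇ j       []          = refl
takeFirst-⊆ᵇ zero    (b ∷ Y)     = takeFirst-⊆ᵇ zero Y
takeFirst-⊆ᵇ (suc j) (false ∷ Y) = takeFirst-⊆ᵇ (suc j) Y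
takeFirst-⊆ᵇ (suc j) (true ∷ Y)  = takeFirst-⊆ᵇ j Y

∣takeFirst∣ : ∀ {k} j (Y : Subset k) → j ≤ ∣ Y ∣ → ∣ takeFirst j Y ∣ ≡ j
∣takeFirst∣ zero    []          _       = refl
∣takeFirst∣ zero    (b ∷ Y)     _       = ∣takeFirst∣ zero Y z≤n
∣takeFirst∣ (suc j) (false ∷ Y) j≤     = ∣takeFirst∣ (suc j) Y j≤
∣takeFirst∣ (suc j) (true ∷ Y)  (s≤s j≤) = cong suc (∣takeFirst∣ j Y j≤)

takeFirst-nonconsecutiveSubset : ∀ {k} j (Y : Subset k) → j ≤ ∣ Y ∣ → nonconsecutive Y ≡ true →
  NonconsecutiveSubset j Y
takeFirst-nonconsecutiveSubset j Y j≤ nc =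
  takeFirst j Y , takeFirst-⊆ᵇ j Y , nonconsecutive-⊆ᵇ (takeFirst j Y) Y (takeFirst-⊆ᵇ j Y) nc , ∣takeFirst∣ j Y j≤

+-self-cancel-≤ : ∀ {a b} → a + a ≤ b + b → a ≤ b
+-self-cancel-≤ {a} {b} a+a≤b+b with a ≤? b
... | yes a≤b = a≤b
... | no  a≰b = contradiction a+a≤b+b (<⇒≱ (+-mono-< (≰⇒> a≰b) (≰⇒> a≰b)))

greedy : ∀ {k} → Subset k → Subset k
greedy []              = []
greedy (false ∷ Y)     = false ∷ greedy Y
greedy (true ∷ [])     = true ∷ []
greedy (true ∷ b ∷ Y)  = true ∷ false ∷ greedy Y

greedy-⊆ᵇ : ∀ {k} (Y : Subset k) → greedy Y ⊆ᵇ Y ≡ true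
greedy-⊆ᵇ []             = refl
greedy-⊆ᵇ (false ∷ Y)    = greedy-⊆ᵇ Y
greedy-⊆ᵇ (true ∷ [])    = refl
greedy-⊆ᵇ (true ∷ b ∷ Y) = greedy-⊆ᵇ Y

greedy-nonconsecutive : ∀ {k} (Y : Subset k) → nonconsecutive (greedy Y) ≡ true
greedy-nonconsecutive []             = refl
greedy-nonconsecutive (false ∷ Y)    = greedy-nonconsecutive Y
greedy-nonconsecutive (true ∷ [])    = refl
greedy-nonconsecutive (true ∷ b ∷ Y) = greedy-nonconsecutive Y

∣∣≤∣greedy∣+∣greedy∣ : ∀ {k} (Y : Subset k) → ∣ Y ∣ ≤ ∣ greedy Y ∣ + ∣ greedy Y ∣
∣∣≤∣greedy∣+∣greedy∣ []             = z≤n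
∣∣≤∣greedy∣+∣greedy∣ (false ∷ Y)    = ∣∣≤∣greedy∣+∣greedy∣ Y
∣∣≤∣greedy∣+∣greedy∣ (true ∷ [])    = s≤s z≤n
∣∣≤∣greedy∣+∣greedy∣ (true ∷ b ∷ Y) = s≤s (begin
  ∣ b ∷ Y ∣               ≤⟨ ∣∷∣≤suc b Y ⟩
  suc ∣ Y ∣               ≤⟨ s≤s (∣∣≤∣greedy∣+∣greedy∣ Y) ⟩
  suc (g + g)             ≡⟨ +-suc g g ⟨
  g + suc g               ∎)
  where
  open ≤-Reasoning
  g = ∣ greedy Y ∣
  ∣∷∣≤suc : ∀ {k} b (Y : Subset k) → ∣ b ∷ Y ∣ ≤ suc ∣ Y ∣
  ∣∷∣≤suc true  Y = ≤-refl
  ∣∷∣≤suc false Y = n≤1+n _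

greedy-nonconsecutiveSubset : ∀ {k} j (Y : Subset k) → j + j ≤ ∣ Y ∣ → NonconsecutiveSubset j Y
greedy-nonconsecutiveSubset j Y 2j≤ with takeFirst-nonconsecutiveSubset j (greedy Y) j≤ (greedy-nonconsecutive Y)
  where
  j≤ : j ≤ ∣ greedy Y ∣
  j≤ = +-self-cancel-≤ (≤-trans 2j≤ (∣∣≤∣greedy∣+∣greedy∣ Y))
... | T , T⊆ , nc , ∣T∣ = T , ⊆ᵇ-trans T (greedy Y) Y T⊆ (greedy-⊆ᵇ Y) , nc , ∣T∣

bit : Bool → ℕ
bit true  = 1
bit false = 0

∣∷∣ : ∀ {k} b (X : Subset k) → ∣ b ∷ X ∣ ≡ bit b + ∣ X ∣
∣∷∣ true  X = refl
∣∷∣ false X = refl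

∣∁farFrom∣≤3*∣∣ : ∀ {k} (I : Subset k) → ∣ ∁ (farFrom I) ∣ ≤ 3 * ∣ I ∣
∣∁farFrom∣≤3*∣∣ I = begin
  ∣ ∁ (farFrom I) ∣                         ≤⟨ bound false I ⟩
  0 + (bit h + bit h) + 3 * ∣tail∣ I        ≤⟨ +-monoˡ-≤ (3 * ∣tail∣ I) (m≤m+n (bit h + bit h) (bit h)) ⟩
  (bit h + bit h + bit h) + 3 * ∣tail∣ I    ≡⟨ distribute (bit h) (∣tail∣ I) ⟩
  3 * (bit h + ∣tail∣ I)                    ≡⟨ cong (3 *_) (∣∣≡head+tail I) ⟨
  3 * ∣ I ∣                                 ∎
  where
  open ≤-Reasoning
  h = startsInside I
  ∣tail∣ : ∀ {k} → Subset k → ℕ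
  ∣tail∣ []      = 0
  ∣tail∣ (_ ∷ X) = ∣ X ∣
  ∣∣≡head+tail : ∀ {k} (X : Subset k) → ∣ X ∣ ≡ bit (startsInside X) + ∣tail∣ X
  ∣∣≡head+tail []      = refl
  ∣∣≡head+tail (b ∷ X) = ∣∷∣ b X
  distribute : ∀ a t → a + a + a + 3 * t ≡ 3 * (a + t)
  distribute = solve-∀
  -- The flag rules out the first position; the first element of I, only itself and its right neighbour.
  bound : ∀ {k} p (I : Subset k) →
    ∣ ∁ (farFromAfter p I) ∣ ≤ bit p + (bit (startsInside I) + bit (startsInside I)) + 3 * ∣tail∣ I
  bound p []      = z≤n
  bound p (i ∷ I) = begin
    ∣ ∁ (farFromAfter p (i ∷ I)) ∣                     ≡⟨ ∣∷∣ (not (not (p ∨ i ∨ h′))) (∁ (farFromAfter i I)) ⟩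
    bit (not (not (p ∨ i ∨ h′))) + ∣ ∁ (farFromAfter i I) ∣
      ≤⟨ +-mono-≤ (bit-∨₃ p i h′) (bound i I) ⟩
    bit p + bit i + bit h′ + (bit i + (bit h′ + bit h′) + 3 * ∣tail∣ I)
      ≡⟨ regroup (bit p) (bit i) (bit h′) (∣tail∣ I) ⟩
    bit p + (bit i + bit i) + 3 * (bit h′ + ∣tail∣ I)
      ≡⟨ cong (λ t → bit p + (bit i + bit i) + 3 * t) (∣∣≡head+tail I) ⟨
    bit p + (bit i + bit i) + 3 * ∣ I ∣                ∎
    where
    h′ = startsInside I
    bit-∨₃ : ∀ a b c → bit (not (not (a ∨ b ∨ c))) ≤ bit a + bit b + bit c
    bit-∨₃ true  b     c     = s≤s z≤n
    bit-∨₃ false true  c     = s≤s z≤n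
    bit-∨₃ false false true  = s≤s z≤n
    bit-∨₃ false false false = z≤n
    regroup : ∀ a b c d → a + b + c + (b + (c + c) + 3 * d) ≡ a + (b + b) + 3 * (c + d)
    regroup = solve-∀

k≤∣∁a∣+∣∁b∣+∣∁s∩a∣+∣s∩b∣ : ∀ {k} (s a b : Subset k) → k ≤ ∣ ∁ a ∣ + ∣ ∁ b ∣ + (∣ ∁ s ∩ a ∣ + ∣ s ∩ b ∣)
k≤∣∁a∣+∣∁b∣+∣∁s∩a∣+∣s∩b∣ []      []      []      = z≤n
k≤∣∁a∣+∣∁b∣+∣∁s∩a∣+∣s∩b∣ (x ∷ s) (y ∷ a) (z ∷ b) = begin
  suc _                                               ≤⟨ +-mono-≤ (covered x y z) (k≤∣∁a∣+∣∁b∣+∣∁s∩a∣+∣s∩b∣ s a b) ⟩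
  bit y′ + bit z′ + (bit u + bit v) + (A + B + (C + D)) ≡⟨ interchange (bit y′) (bit z′) (bit u) (bit v) A B C D ⟩
  bit y′ + A + (bit z′ + B) + (bit u + C + (bit v + D)) ≡⟨ cong₂ _+_ (cong₂ _+_ (∣∷∣ y′ (∁ a)) (∣∷∣ z′ (∁ b)))
                                                                 (cong₂ _+_ (∣∷∣ u (∁ s ∩ a)) (∣∷∣ v (s ∩ b))) ⟨
  ∣ ∁ (y ∷ a) ∣ + ∣ ∁ (z ∷ b) ∣ + (∣ ∁ (x ∷ s) ∩ (y ∷ a) ∣ + ∣ (x ∷ s) ∩ (z ∷ b) ∣) ∎
  where
  open ≤-Reasoning
  y′ = not y
  z′ = not z
  u = not x ∧ y
  v = x ∧ z
  A = ∣ ∁ a ∣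
  B = ∣ ∁ b ∣
  C = ∣ ∁ s ∩ a ∣
  D = ∣ s ∩ b ∣
  covered : ∀ x y z → 1 ≤ bit (not y) + bit (not z) + (bit (not x ∧ y) + bit (x ∧ z))
  covered x     false z     = s≤s z≤n
  covered x     true  false = s≤s z≤n
  covered true  true  true  = s≤s z≤n
  covered false true  true  = s≤s z≤n
  interchange : ∀ a b c d a′ b′ c′ d′ →
    a + b + (c + d) + (a′ + b′ + (c′ + d′)) ≡ a + a′ + (b + b′) + (c + c′ + (d + d′))
  interchange = solve-∀

alternating : Bool → (k : ℕ) → Subset k
alternating b zero    = []
alternating b (suc k) = b ∷ alternating (not b) k

alternating-nonconsecutiveAfter : ∀ b k p → (p ≡ true → b ≡ false) → nonconsecutiveAfter p (alternating b k) ≡ true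
alternating-nonconsecutiveAfter b     zero    p     _ = refl
alternating-nonconsecutiveAfter true  (suc k) false _ = alternating-nonconsecutiveAfter false k true (λ _ → refl)
alternating-nonconsecutiveAfter true  (suc k) true  p⇒b with () ← p⇒b refl
alternating-nonconsecutiveAfter false (suc k) p     _ rewrite ∧-zeroʳ p =
  alternating-nonconsecutiveAfter true k false (λ ())

∣alternating∣ : ∀ k →
  k ≤ ∣ alternating true k ∣ + ∣ alternating true k ∣ × k ≤ suc (∣ alternating false k ∣ + ∣ alternating false k ∣)
∣alternating∣ zero    = z≤n , z≤n
∣alternating∣ (suc k) with ∣alternating∣ k
... | odd , even = ≤-trans (s≤s even) (≤-reflexive (cong suc (sym (+-suc _ _)))) , s≤s odd

BalancedSextet : ∀ {k} → Subset k → Set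
BalancedSextet {k} s = Σ (Subset k) λ D → nonconsecutive D ≡ true × ∣ s ∩ D ∣ ≡ 3 × ∣ ∁ s ∩ D ∣ ≡ 3

BalancedSextet-∁ : ∀ {k} (s : Subset k) → BalancedSextet (∁ s) → BalancedSextet s
BalancedSextet-∁ s (D , nc , ∣∁s∩D∣ , ∣∁∁s∩D∣) =
  D , nc , subst (λ t → ∣ t ∩ D ∣ ≡ 3) (∁-involutive s) ∣∁∁s∩D∣ , ∣∁s∩D∣

balancedSextet-farFrom : ∀ {k} (s : Subset k) (t : NonconsecutiveSubset 3 s) →
  6 ≤ ∣ ∁ s ∩ farFrom (proj₁ t) ∣ → BalancedSextet s
balancedSextet-farFrom s (T , T⊆s , ncT , ∣T∣) room
  with greedy-nonconsecutiveSubset 3 (∁ s ∩ farFrom T) room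
... | T′ , T′⊆ , ncT′ , ∣T′∣ =
  T ∪ T′ , nonconsecutive-∪-far T T′ ncT ncT′ (⊆ᵇ-trans T′ _ (farFrom T) T′⊆ (∩⊆ᵇʳ (∁ s) (farFrom T))) ,
  trans (cong ∣_∣ (proj₁ parts)) ∣T∣ , trans (cong ∣_∣ (proj₂ parts)) ∣T′∣
  where
  parts = ∩-∪-separated s T T′ T⊆s (⊆ᵇ-trans T′ _ (∁ s) T′⊆ (∩⊆ᵇˡ (∁ s) (farFrom T)))

-- Apart from at most 18 positions near T₁ or T₂, every position lies in ∁ s ∩ farFrom T₁ or s ∩ farFrom T₂.
balancedSextet : ∀ {k} (s : Subset k) → 29 ≤ k → NonconsecutiveSubset 3 s → NonconsecutiveSubset 3 (∁ s) →
  BalancedSextet s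
balancedSextet {k} s 29≤k t₁@(T₁ , _ , _ , ∣T₁∣) t₂@(T₂ , _ , _ , ∣T₂∣) with 6 ≤? ∣ ∁ s ∩ farFrom T₁ ∣
... | yes room₁ = balancedSextet-farFrom s t₁ room₁
... | no ¬room₁ = BalancedSextet-∁ s (balancedSextet-farFrom (∁ s) t₂
                    (subst (λ t → 6 ≤ ∣ t ∩ farFrom T₂ ∣) (sym (∁-involutive s)) room₂))
  where
  open ≤-Reasoning
  ∣∁farFrom∣≤9 : ∀ (T : Subset k) → ∣ T ∣ ≡ 3 → ∣ ∁ (farFrom T) ∣ ≤ 9
  ∣∁farFrom∣≤9 T ∣T∣≡3 = ≤-trans (∣∁farFrom∣≤3*∣∣ T) (≤-reflexive (cong (3 *_) ∣T∣≡3))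
  z₂ = ∣ s ∩ farFrom T₂ ∣
  room₂ : 6 ≤ z₂
  room₂ = +-cancelˡ-≤ 23 6 z₂ (begin
    29                                        ≤⟨ 29≤k ⟩
    k                                         ≤⟨ k≤∣∁a∣+∣∁b∣+∣∁s∩a∣+∣s∩b∣ s (farFrom T₁) (farFrom T₂) ⟩
    ∣ ∁ (farFrom T₁) ∣ + ∣ ∁ (farFrom T₂) ∣ + (∣ ∁ s ∩ farFrom T₁ ∣ + z₂)
      ≤⟨ +-mono-≤ (+-mono-≤ (∣∁farFrom∣≤9 T₁ ∣T₁∣) (∣∁farFrom∣≤9 T₂ ∣T₂∣)) (+-monoˡ-≤ z₂ (≤-pred (≰⇒> ¬room₁))) ⟩
    23 + z₂                                   ∎)

k≤∣∣+∣∁∣ : ∀ {k} (X : Subset k) → k ≤ ∣ X ∣ + ∣ ∁ X ∣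
k≤∣∣+∣∁∣ {k} X = ≤-trans (m≤n+m∸n k ∣ X ∣) (≤-reflexive (sym (cong (∣ X ∣ +_) (∣∁p∣≡n∸∣p∣ X))))

farFrom-nonconsecutiveSubset : ∀ {k} (I : Subset k) → ∣ I ∣ ≤ 5 → 25 ≤ k → NonconsecutiveSubset 5 (farFrom I)
farFrom-nonconsecutiveSubset {k} I ∣I∣≤5 25≤k = greedy-nonconsecutiveSubset 5 (farFrom I)
  (+-cancelʳ-≤ 15 10 ∣ farFrom I ∣ (begin
    25                                   ≤⟨ 25≤k ⟩
    k                                    ≤⟨ k≤∣∣+∣∁∣ (farFrom I) ⟩
    ∣ farFrom I ∣ + ∣ ∁ (farFrom I) ∣
      ≤⟨ +-monoʳ-≤ ∣ farFrom I ∣ (≤-trans (∣∁farFrom∣≤3*∣∣ I) (*-monoʳ-≤ 3 ∣I∣≤5)) ⟩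
    ∣ farFrom I ∣ + 15                   ∎))
  where open ≤-Reasoning

nonconsecutiveSubset? : ∀ {k} j (s : Subset k) → Dec (NonconsecutiveSubset j s)
nonconsecutiveSubset? j s =
  anySubset? λ T → (T ⊆ᵇ s Bool.≟ true) ×-dec (nonconsecutive T Bool.≟ true) ×-dec (∣ T ∣ ℕ.≟ j)

nonconsecutiveSubset-∩ : ∀ {k} j (s X : Subset k) → nonconsecutive X ≡ true → j ≤ ∣ s ∩ X ∣ → NonconsecutiveSubset j s
nonconsecutiveSubset-∩ j s X ncX j≤ =
  let T , T⊆ , ncT , ∣T∣ = takeFirst-nonconsecutiveSubset j (s ∩ X) j≤ (nonconsecutive-⊆ᵇ (s ∩ X) X (∩⊆ᵇʳ s X) ncX)
  in T , ⊆ᵇ-trans T (s ∩ X) s T⊆ (∩⊆ᵇˡ s X) , ncT , ∣T∣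

Nonconsecutive-∷⁻ : ∀ {k b} {I : Subset k} → Nonconsecutive (b ∷ I) → Nonconsecutive I
Nonconsecutive-∷⁻ nc i j i∈ j∈ j≡i+1 = nc (suc i) (suc j) (there i∈) (there j∈) (cong suc j≡i+1)

Nonconsecutive⇒nonconsecutiveAfter : ∀ {k} p (I : Subset k) → Nonconsecutive I → (p ≡ true → startsInside I ≡ false) →
  nonconsecutiveAfter p I ≡ true
Nonconsecutive⇒nonconsecutiveAfter p     []          _  _       = refl
Nonconsecutive⇒nonconsecutiveAfter false (true ∷ I)  nc _       =
  Nonconsecutive⇒nonconsecutiveAfter true I (Nonconsecutive-∷⁻ nc) (λ _ → second-outside I nc)
  where
  second-outside : ∀ {k} (I : Subset k) → Nonconsecutive (true ∷ I) → startsInside I ≡ false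
  second-outside []          _  = refl
  second-outside (false ∷ I) _  = refl
  second-outside (true ∷ I)  nc = contradiction refl (nc zero (suc zero) here (there here))
Nonconsecutive⇒nonconsecutiveAfter p     (false ∷ I) nc _ rewrite ∧-zeroʳ p =
  Nonconsecutive⇒nonconsecutiveAfter false I (Nonconsecutive-∷⁻ nc) (λ ())
Nonconsecutive⇒nonconsecutiveAfter true  (true ∷ I)  _  p⇒first with () ← p⇒first refl

Nonconsecutive⇒nonconsecutive : ∀ {k} (I : Subset k) → Nonconsecutive I → nonconsecutive I ≡ true
Nonconsecutive⇒nonconsecutive I nc = Nonconsecutive⇒nonconsecutiveAfter false I nc (λ ())

Nonconsecutive⇒NonconsecutiveSubset : ∀ {k j} {s : Subset k} I → Nonconsecutive I → ∣ I ∣ ≡ j → I ⊆ᵇ s ≡ true →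
  NonconsecutiveSubset j s
Nonconsecutive⇒NonconsecutiveSubset I nc ∣I∣ I⊆s = I , I⊆s , Nonconsecutive⇒nonconsecutive I nc , ∣I∣

-- Binomial coefficients

-- binomial k r = C(k + r, k), the number of words with k ones and r zeros.
binomial : ℕ → ℕ → ℕ
binomial zero    r       = 1
binomial (suc k) zero    = 1
binomial (suc k) (suc r) = binomial k (suc r) + binomial (suc k) r

binomial-comm : ∀ k r → binomial k r ≡ binomial r k
binomial-comm zero    zero    = refl
binomial-comm zero    (suc r) = refl
binomial-comm (suc k) zero    = refl
binomial-comm (suc k) (suc r) =
  trans (cong₂ _+_ (binomial-comm k (suc r)) (binomial-comm (suc k) r))
        (+-comm (binomial (suc r) k) (binomial r (suc k)))

binomial-1 : ∀ t → binomial 1 t ≡ suc t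
binomial-1 zero    = refl
binomial-1 (suc t) = cong suc (binomial-1 t)

binomial-2 : ∀ t → 2 * binomial 2 t ≡ (t + 1) * (t + 2)
binomial-2 zero    = refl
binomial-2 (suc t) = begin
  2 * (binomial 1 (suc t) + binomial 2 t)   ≡⟨ *-distribˡ-+ 2 (binomial 1 (suc t)) (binomial 2 t) ⟩
  2 * binomial 1 (suc t) + 2 * binomial 2 t ≡⟨ cong₂ (λ a b → 2 * a + b) (binomial-1 (suc t)) (binomial-2 t) ⟩
  2 * suc (suc t) + (t + 1) * (t + 2)       ≡⟨ pascal t ⟩
  (suc t + 1) * (suc t + 2)                 ∎
  where
  open ≡-Reasoning
  pascal : ∀ t → 2 * suc (suc t) + (t + 1) * (t + 2) ≡ (suc t + 1) * (suc t + 2)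
  pascal = solve-∀

binomial-3 : ∀ t → 6 * binomial 3 t ≡ (t + 1) * (t + 2) * (t + 3)
binomial-3 zero    = refl
binomial-3 (suc t) = begin
  6 * (binomial 2 (suc t) + binomial 3 t)        ≡⟨ *-distribˡ-+ 6 (binomial 2 (suc t)) (binomial 3 t) ⟩
  6 * binomial 2 (suc t) + 6 * binomial 3 t      ≡⟨ cong (_+ 6 * binomial 3 t) (*-assoc 3 2 (binomial 2 (suc t))) ⟩
  3 * (2 * binomial 2 (suc t)) + 6 * binomial 3 t ≡⟨ cong₂ (λ a b → 3 * a + b) (binomial-2 (suc t)) (binomial-3 t) ⟩
  3 * ((suc t + 1) * (suc t + 2)) + (t + 1) * (t + 2) * (t + 3) ≡⟨ pascal t ⟩
  (suc t + 1) * (suc t + 2) * (suc t + 3)        ∎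
  where
  open ≡-Reasoning
  pascal : ∀ t →
    3 * ((suc t + 1) * (suc t + 2)) + (t + 1) * (t + 2) * (t + 3) ≡ (suc t + 1) * (suc t + 2) * (suc t + 3)
  pascal = solve-∀

binomial-2≤binomial-3 : ∀ t → binomial 2 (suc (2 + t)) ≤ binomial 3 (2 + t)
binomial-2≤binomial-3 t = *-cancelˡ-≤ 6 (begin
  6 * binomial 2 (3 + t)             ≡⟨ *-assoc 3 2 (binomial 2 (3 + t)) ⟩
  3 * (2 * binomial 2 (3 + t))       ≡⟨ cong (3 *_) (binomial-2 (3 + t)) ⟩
  3 * ((3 + t + 1) * (3 + t + 2))    ≤⟨ m≤m+n _ (t * ((t + 4) * (t + 5))) ⟩
  3 * ((3 + t + 1) * (3 + t + 2)) + t * ((t + 4) * (t + 5)) ≡⟨ expand t ⟩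
  (2 + t + 1) * (2 + t + 2) * (2 + t + 3) ≡⟨ binomial-3 (2 + t) ⟨
  6 * binomial 3 (2 + t)             ∎)
  where
  open ≤-Reasoning
  expand : ∀ t → 3 * ((3 + t + 1) * (3 + t + 2)) + t * ((t + 4) * (t + 5)) ≡ (2 + t + 1) * (2 + t + 2) * (2 + t + 3)
  expand = solve-∀

binomial-3≤binomial : ∀ a b → binomial 3 (3 + (a + b)) ≤ binomial (3 + a) (3 + b)
binomial-3≤binomial zero    b       = ≤-refl
binomial-3≤binomial (suc a) zero    rewrite +-identityʳ a = ≤-reflexive (binomial-comm 3 (3 + suc a))
binomial-3≤binomial (suc a) (suc b) = begin
  binomial 3 (suc t)           ≤⟨ +-monoˡ-≤ (binomial 3 t) (binomial-2≤binomial-3 (1 + (a + suc b))) ⟩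
  binomial 3 t + binomial 3 t  ≤⟨ +-mono-≤ (binomial-3≤binomial a (suc b)) right ⟩
  binomial (3 + a) (3 + suc b) + binomial (3 + suc a) (3 + b) ∎
  where
  open ≤-Reasoning
  t = 3 + (a + suc b)
  right : binomial 3 t ≤ binomial (3 + suc a) (3 + b)
  right = subst (λ z → binomial 3 (3 + z) ≤ binomial (3 + suc a) (3 + b)) (sym (+-suc a b))
                (binomial-3≤binomial (suc a) b)

m*[m∸2]≤binomial : ∀ m k r → 51 ≤ m → m ≤ (k + r) + (k + r) → 3 ≤ k → 3 ≤ r → m * (m ∸ 2) ≤ binomial k r
m*[m∸2]≤binomial m k r 51≤m m≤2L 3≤k 3≤r
  rewrite sym (m+[n∸m]≡n 3≤k) | sym (m+[n∸m]≡n 3≤r) = begin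
  m * (m ∸ 2)                          ≤⟨ *-mono-≤ m≤2L′ (∸-monoˡ-≤ 2 m≤2L′) ⟩
  (L + L) * (4 + (x + L))              ≤⟨ *-cancelˡ-≤ 6 cubic ⟩
  binomial 3 (3 + x)                   ≤⟨ binomial-3≤binomial a b ⟩
  binomial (3 + a) (3 + b)             ∎
  where
  open ≤-Reasoning
  a = k ∸ 3
  b = r ∸ 3
  x = a + b
  L = 6 + x
  m≤2L′ : m ≤ L + L
  m≤2L′ = subst (λ z → m ≤ z + z) (regroup a b) m≤2L
    where
    regroup : ∀ a b → 3 + a + (3 + b) ≡ 6 + (a + b)
    regroup = solve-∀
  20≤x : 20 ≤ x
  20≤x with 20 ≤? x
  ... | yes 20≤x = 20≤x
  ... | no  20≰x = contradiction (≤-trans 51≤m m≤2L′) (<⇒≱ (s≤s (+-mono-≤ L≤25 L≤25)))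
    where
    L≤25 : L ≤ 25
    L≤25 = +-monoʳ-≤ 6 (≤-pred (≰⇒> 20≰x))
  u = x ∸ 20
  20+u≡x : 20 + u ≡ x
  20+u≡x = m+[n∸m]≡n 20≤x
  cubic : 6 * ((L + L) * (4 + (x + L))) ≤ 6 * binomial 3 (3 + x)
  cubic = begin
    6 * ((L + L) * (4 + (x + L)))               ≡⟨ quadratic x ⟩
    24 * ((x + 6) * (x + 5))                    ≡⟨ cong (λ y → 24 * ((y + 6) * (y + 5))) 20+u≡x ⟨
    24 * ((20 + u + 6) * (20 + u + 5))          ≤⟨ m≤m+n _ (u * ((20 + u + 6) * (20 + u + 5))) ⟩
    24 * ((20 + u + 6) * (20 + u + 5)) + u * ((20 + u + 6) * (20 + u + 5)) ≡⟨ factor u ⟩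
    (20 + u + 4) * (20 + u + 5) * (20 + u + 6)  ≡⟨ cong (λ y → (y + 4) * (y + 5) * (y + 6)) 20+u≡x ⟩
    (x + 4) * (x + 5) * (x + 6)                 ≡⟨ reindex x ⟩
    (3 + x + 1) * (3 + x + 2) * (3 + x + 3)     ≡⟨ binomial-3 (3 + x) ⟨
    6 * binomial 3 (3 + x)                      ∎
    where
    quadratic : ∀ x → 6 * ((6 + x + (6 + x)) * (4 + (x + (6 + x)))) ≡ 24 * ((x + 6) * (x + 5))
    quadratic = solve-∀
    factor : ∀ u → 24 * ((20 + u + 6) * (20 + u + 5)) + u * ((20 + u + 6) * (20 + u + 5))
                 ≡ (20 + u + 4) * (20 + u + 5) * (20 + u + 6)
    factor = solve-∀
    reindex : ∀ x → (x + 4) * (x + 5) * (x + 6) ≡ (3 + x + 1) * (3 + x + 2) * (3 + x + 3)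
    reindex = solve-∀

-- Traces and inclusion–exclusion

weight : List Bool → ℕ
weight []          = 0
weight (true ∷ w)  = suc (weight w)
weight (false ∷ w) = weight w

weight-replicate-false : ∀ j → weight (List.replicate j false) ≡ 0
weight-replicate-false zero    = refl
weight-replicate-false (suc j) = weight-replicate-false j

weight-replicate-true : ∀ j → weight (List.replicate j true) ≡ j
weight-replicate-true zero    = refl
weight-replicate-true (suc j) = cong suc (weight-replicate-true j)

trace : ∀ {m} → Subset m → List (Fin m) → List Bool
trace s Q = List.map (lookup s) Q

extend : ∀ {m} → List (Fin m) → List Bool → Subset m → Subset m
extend []      c           P = P
extend (q ∷ Q) []          P = P
extend (q ∷ Q) (true ∷ c)  P = extend Q c (P ∪ ⁅ q ⁆)
extend (q ∷ Q) (false ∷ c) P = extend Q c P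

∪⁅⁆-⊆ᵇ : ∀ {m} (P : Subset m) q s → P ∪ ⁅ q ⁆ ⊆ᵇ s ≡ (P ⊆ᵇ s) ∧ lookup s q
∪⁅⁆-⊆ᵇ P q s = trans (∪-⊆ᵇ P ⁅ q ⁆ s) (cong ((P ⊆ᵇ s) ∧_) (⁅⁆-⊆ᵇ q s))

lookup-∪⁅⁆ : ∀ {m} (P : Subset m) {q r} → q ≢ r → lookup (P ∪ ⁅ q ⁆) r ≡ lookup P r
lookup-∪⁅⁆ (b ∷ P) {zero}  {zero}  q≢r = contradiction refl q≢r
lookup-∪⁅⁆ (b ∷ P) {zero}  {suc r} q≢r = cong (λ X → lookup X r) (∪-identityʳ P)
lookup-∪⁅⁆ (b ∷ P) {suc q} {zero}  q≢r = ∨-identityʳ b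
lookup-∪⁅⁆ (b ∷ P) {suc q} {suc r} q≢r = lookup-∪⁅⁆ P (λ q≡r → q≢r (cong suc q≡r))

∣∪⁅⁆∣ : ∀ {m} (P : Subset m) q → lookup P q ≡ false → ∣ P ∪ ⁅ q ⁆ ∣ ≡ suc ∣ P ∣
∣∪⁅⁆∣ (false ∷ P) zero    _      = cong suc (cong ∣_∣ (∪-identityʳ P))
∣∪⁅⁆∣ (true ∷ P)  (suc q) q∉P    = cong suc (∣∪⁅⁆∣ P q q∉P)
∣∪⁅⁆∣ (false ∷ P) (suc q) q∉P    = ∣∪⁅⁆∣ P q q∉P

extend-∪ : ∀ {m} Q c (I P : Subset m) → extend Q c (I ∪ P) ≡ I ∪ extend Q c P
extend-∪ []      c           I P = refl
extend-∪ (q ∷ Q) []          I P = refl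
extend-∪ (q ∷ Q) (true ∷ c)  I P = trans (cong (extend Q c) (∪-assoc I P ⁅ q ⁆)) (extend-∪ Q c I (P ∪ ⁅ q ⁆))
extend-∪ (q ∷ Q) (false ∷ c) I P = extend-∪ Q c I P

extend-⊆ᵇ : ∀ {m} Q c (P Y : Subset m) → P ⊆ᵇ Y ≡ true → All (λ q → lookup Y q ≡ true) Q → extend Q c P ⊆ᵇ Y ≡ true
extend-⊆ᵇ []      c           P Y P⊆Y _            = P⊆Y
extend-⊆ᵇ (q ∷ Q) []          P Y P⊆Y _            = P⊆Y
extend-⊆ᵇ (q ∷ Q) (true ∷ c)  P Y P⊆Y (q∈Y ∷ Q⊆Y) =
  extend-⊆ᵇ Q c (P ∪ ⁅ q ⁆) Y (trans (∪⁅⁆-⊆ᵇ P q Y) (∧-intro P⊆Y q∈Y)) Q⊆Y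
extend-⊆ᵇ (q ∷ Q) (false ∷ c) P Y P⊆Y (_ ∷ Q⊆Y)   = extend-⊆ᵇ Q c P Y P⊆Y Q⊆Y

⊆ᵇ-extend : ∀ {m} Q c (P s : Subset m) → extend Q c P ⊆ᵇ s ≡ true → P ⊆ᵇ s ≡ true
⊆ᵇ-extend []      c           P s ext⊆s = ext⊆s
⊆ᵇ-extend (q ∷ Q) []          P s ext⊆s = ext⊆s
⊆ᵇ-extend (q ∷ Q) (true ∷ c)  P s ext⊆s =
  ∧-conicalˡ _ _ (trans (sym (∪⁅⁆-⊆ᵇ P q s)) (⊆ᵇ-extend Q c (P ∪ ⁅ q ⁆) s ext⊆s))
⊆ᵇ-extend (q ∷ Q) (false ∷ c) P s ext⊆s = ⊆ᵇ-extend Q c P s ext⊆s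

lookup-extend : ∀ {m} Q c (P : Subset m) r → All (_≢ r) Q → lookup (extend Q c P) r ≡ lookup P r
lookup-extend []      c           P r _           = refl
lookup-extend (q ∷ Q) []          P r _           = refl
lookup-extend (q ∷ Q) (true ∷ c)  P r (q≢r ∷ Q≢r) = trans (lookup-extend Q c (P ∪ ⁅ q ⁆) r Q≢r) (lookup-∪⁅⁆ P q≢r)
lookup-extend (q ∷ Q) (false ∷ c) P r (_ ∷ Q≢r)   = lookup-extend Q c P r Q≢r

∉-∪⁅⁆ : ∀ {m} (P : Subset m) q (Q : List (Fin m)) → All (q ≢_) Q → All (λ r → lookup P r ≡ false) Q →
  All (λ r → lookup (P ∪ ⁅ q ⁆) r ≡ false) Q
∉-∪⁅⁆ P q Q q≢Q Q∉P = All.zipWith (λ (q≢r , r∉P) → trans (lookup-∪⁅⁆ P q≢r) r∉P) (q≢Q , Q∉P)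

∣extend∣ : ∀ {m} Q c (P : Subset m) → Unique Q → All (λ q → lookup P q ≡ false) Q → length c ≡ length Q →
  ∣ extend Q c P ∣ ≡ ∣ P ∣ + weight c
∣extend∣ []      []          P _              _           _   = sym (+-identityʳ ∣ P ∣)
∣extend∣ (q ∷ Q) (true ∷ c)  P (q≢Q ∷ uniq) (q∉P ∷ Q∉P) len = begin
  ∣ extend Q c (P ∪ ⁅ q ⁆) ∣     ≡⟨ ∣extend∣ Q c (P ∪ ⁅ q ⁆) uniq (∉-∪⁅⁆ P q Q q≢Q Q∉P) (suc-injective len) ⟩
  ∣ P ∪ ⁅ q ⁆ ∣ + weight c        ≡⟨ cong (_+ weight c) (∣∪⁅⁆∣ P q q∉P) ⟩
  suc ∣ P ∣ + weight c            ≡⟨ +-suc ∣ P ∣ (weight c) ⟨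
  ∣ P ∣ + suc (weight c)          ∎
  where open ≡-Reasoning
∣extend∣ (q ∷ Q) (false ∷ c) P (_ ∷ uniq)   (_ ∷ Q∉P)   len = ∣extend∣ Q c P uniq Q∉P (suc-injective len)

elements : ∀ {k} → Subset k → List (Fin k)
elements []          = []
elements (true ∷ X)  = zero ∷ List.map suc (elements X)
elements (false ∷ X) = List.map suc (elements X)

length-elements : ∀ {k} (X : Subset k) → length (elements X) ≡ ∣ X ∣
length-elements []          = refl
length-elements (true ∷ X)  = cong suc (trans (length-map suc (elements X)) (length-elements X))
length-elements (false ∷ X) = trans (length-map suc (elements X)) (length-elements X)

elements-unique : ∀ {k} (X : Subset k) → Unique (elements X)
elements-unique []          = []
elements-unique (true ∷ X)  = zero∉ (elements X) ∷ Uniqueₚ.map⁺ Fin-suc-injective (elements-unique X)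
  where
  zero∉ : ∀ {k} (Q : List (Fin k)) → All (_≢_ {A = Fin (suc k)} zero) (List.map suc Q)
  zero∉ []      = []
  zero∉ (q ∷ Q) = (λ ()) ∷ zero∉ Q
elements-unique (false ∷ X) = Uniqueₚ.map⁺ Fin-suc-injective (elements-unique X)

elements-∈ : ∀ {k} (X : Subset k) → All (λ q → lookup X q ≡ true) (elements X)
elements-∈ []          = []
elements-∈ (true ∷ X)  = refl ∷ Allₚ.map⁺ (elements-∈ X)
elements-∈ (false ∷ X) = Allₚ.map⁺ (elements-∈ X)

trace-∷-map-suc : ∀ {k} b (s : Subset k) Q → trace (b ∷ s) (List.map suc Q) ≡ trace s Q
trace-∷-map-suc b s Q = sym (Listₚ.map-∘ Q)

weight-trace-elements : ∀ {k} (s X : Subset k) → weight (trace s (elements X)) ≡ ∣ s ∩ X ∣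
weight-trace-elements []          []          = refl
weight-trace-elements (true ∷ s)  (true ∷ X)  =
  cong suc (trans (cong weight (trace-∷-map-suc true s (elements X))) (weight-trace-elements s X))
weight-trace-elements (false ∷ s) (true ∷ X)  =
  trans (cong weight (trace-∷-map-suc false s (elements X))) (weight-trace-elements s X)
weight-trace-elements (b ∷ s)     (false ∷ X) rewrite ∧-zeroʳ b =
  trans (cong weight (trace-∷-map-suc b s (elements X))) (weight-trace-elements s X)

unselected : ∀ {m} → List (Fin m) → List Bool → List (Fin m)
unselected []      c           = []
unselected (q ∷ Q) []          = []
unselected (q ∷ Q) (true ∷ c)  = unselected Q c
unselected (q ∷ Q) (false ∷ c) = q ∷ unselected Q c

unselected-All : ∀ {m} {R : Fin m → Set} Q c → All R Q → All R (unselected Q c)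
unselected-All []      c           _        = []
unselected-All (q ∷ Q) []          _        = []
unselected-All (q ∷ Q) (true ∷ c)  (_ ∷ RQ) = unselected-All Q c RQ
unselected-All (q ∷ Q) (false ∷ c) (Rq ∷ RQ) = Rq ∷ unselected-All Q c RQ

unselected-unique : ∀ {m} (Q : List (Fin m)) c → Unique Q → Unique (unselected Q c)
unselected-unique []      c           _            = []
unselected-unique (q ∷ Q) []          _            = []
unselected-unique (q ∷ Q) (true ∷ c)  (_ ∷ uniq)   = unselected-unique Q c uniq
unselected-unique (q ∷ Q) (false ∷ c) (q≢Q ∷ uniq) = unselected-All Q c q≢Q ∷ unselected-unique Q c uniq

unselected-∉-extend : ∀ {m} (Q : List (Fin m)) c P → Unique Q → All (λ q → lookup P q ≡ false) Q →
  All (λ q → lookup (extend Q c P) q ≡ false) (unselected Q c)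
unselected-∉-extend []      c           P _            _           = []
unselected-∉-extend (q ∷ Q) []          P _            _           = []
unselected-∉-extend (q ∷ Q) (true ∷ c)  P (q≢Q ∷ uniq) (_ ∷ Q∉P)   =
  unselected-∉-extend Q c (P ∪ ⁅ q ⁆) uniq (∉-∪⁅⁆ P q Q q≢Q Q∉P)
unselected-∉-extend (q ∷ Q) (false ∷ c) P (q≢Q ∷ uniq) (q∉P ∷ Q∉P) =
  trans (lookup-extend Q c P q (All.map ≢-sym q≢Q)) q∉P ∷ unselected-∉-extend Q c P uniq Q∉P

length-unselected : ∀ {m} (Q : List (Fin m)) c → length c ≡ length Q → length (unselected Q c) + weight c ≡ length Q
length-unselected []      []          _   = refl
length-unselected (q ∷ Q) (true ∷ c)  len =
  trans (+-suc _ (weight c)) (cong suc (length-unselected Q c (suc-injective len)))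
length-unselected (q ∷ Q) (false ∷ c) len = cong suc (length-unselected Q c (suc-injective len))

extend-trace-⊆ᵇ : ∀ {m} (Q : List (Fin m)) P s → extend Q (trace s Q) P ⊆ᵇ s ≡ P ⊆ᵇ s
extend-trace-⊆ᵇ []      P s = refl
extend-trace-⊆ᵇ (q ∷ Q) P s with lookup s q in q∈s
... | true  = trans (extend-trace-⊆ᵇ Q (P ∪ ⁅ q ⁆) s)
                (trans (∪⁅⁆-⊆ᵇ P q s) (trans (cong ((P ⊆ᵇ s) ∧_) q∈s) (∧-identityʳ _)))
... | false = extend-trace-⊆ᵇ Q P s

none-unselected-trace : ∀ {m} (Q : List (Fin m)) s → all not (trace s (unselected Q (trace s Q))) ≡ true
none-unselected-trace []      s = refl
none-unselected-trace (q ∷ Q) s with lookup s q in q∈s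
... | true  = none-unselected-trace Q s
... | false rewrite q∈s = none-unselected-trace Q s

trace-determined : ∀ {m} (Q : List (Fin m)) c P s → length c ≡ length Q → extend Q c P ⊆ᵇ s ≡ true →
  all not (trace s (unselected Q c)) ≡ true → trace s Q ≡ c
trace-determined []      []          P s _   _     _    = refl
trace-determined (q ∷ Q) (true ∷ c)  P s len ext⊆s none =
  cong₂ _∷_ (∧-conicalʳ _ _ (trans (sym (∪⁅⁆-⊆ᵇ P q s)) (⊆ᵇ-extend Q c (P ∪ ⁅ q ⁆) s ext⊆s)))
            (trace-determined Q c (P ∪ ⁅ q ⁆) s (suc-injective len) ext⊆s none)
trace-determined (q ∷ Q) (false ∷ c) P s len ext⊆s none =
  cong₂ _∷_ (not-injective (∧-conicalˡ _ _ none))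
            (trace-determined Q c P s (suc-injective len) ext⊆s (∧-conicalʳ _ _ none))

-- The fields ensure that I ∪ P together with any part of Q has the runs of I plus isolated points.
record Scattered {m} (I P : Subset m) (Q : List (Fin m)) : Set where
  field
    hull                : Subset m
    hull-nonconsecutive : nonconsecutive hull ≡ true
    hull-farFrom        : hull ⊆ᵇ farFrom I ≡ true
    base⊆hull           : P ⊆ᵇ hull ≡ true
    entries∈hull        : All (λ q → lookup hull q ≡ true) Q
    entries-unique      : Unique Q
    entries∉base        : All (λ q → lookup P q ≡ false) Q

∉∅ : ∀ {m} (Q : List (Fin m)) → All (λ q → lookup ∅ q ≡ false) Q
∉∅ []      = []
∉∅ (q ∷ Q) = lookup-replicate q false ∷ ∉∅ Q

elements-Scattered : ∀ {m} (I X : Subset m) → nonconsecutive X ≡ true → X ⊆ᵇ farFrom I ≡ true →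
  Scattered I ∅ (elements X)
elements-Scattered I X nc far = record
  { hull = X ; hull-nonconsecutive = nc ; hull-farFrom = far ; base⊆hull = ∅⊆ᵇ X
  ; entries∈hull = elements-∈ X ; entries-unique = elements-unique X ; entries∉base = ∉∅ (elements X) }

module _ {m} {I P : Subset m} {Q : List (Fin m)} (sc : Scattered I P Q) where
  open Scattered sc

  extend-⊆ᵇ-hull : ∀ c → extend Q c P ⊆ᵇ hull ≡ true
  extend-⊆ᵇ-hull c = extend-⊆ᵇ Q c P hull base⊆hull entries∈hull

  extend-nonconsecutive : ∀ c → nonconsecutive (extend Q c P) ≡ true
  extend-nonconsecutive c = nonconsecutive-⊆ᵇ (extend Q c P) hull (extend-⊆ᵇ-hull c) hull-nonconsecutive

  extend-farFrom : ∀ c → extend Q c P ⊆ᵇ farFrom I ≡ true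
  extend-farFrom c = ⊆ᵇ-trans (extend Q c P) hull (farFrom I) (extend-⊆ᵇ-hull c) hull-farFrom

  ∣extend∣-Scattered : ∀ c → length c ≡ length Q → ∣ extend Q c P ∣ ≡ ∣ P ∣ + weight c
  ∣extend∣-Scattered c len = ∣extend∣ Q c P entries-unique entries∉base len

runDecomposition-extend : ∀ {m} {I J P P′ : Subset m} {Q Q′} → runDecomposition I ≡ runDecomposition J →
  Scattered I P Q → Scattered J P′ Q′ → ∣ P ∣ ≡ ∣ P′ ∣ → length Q ≡ length Q′ →
  ∀ c → length c ≡ length Q → runDecomposition (extend Q c (I ∪ P)) ≡ runDecomposition (extend Q′ c (J ∪ P′))
runDecomposition-extend {I = I} {J} {P} {P′} {Q} {Q′} I≈J sc sc′ ∣P∣≡ len c lenc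
  rewrite extend-∪ Q c I P | extend-∪ Q′ c J P′ =
  runDecomposition-∪-far I J (extend Q c P) (extend Q′ c P′) I≈J
    (extend-nonconsecutive sc c) (extend-farFrom sc c) (extend-nonconsecutive sc′ c) (extend-farFrom sc′ c)
    (trans (∣extend∣-Scattered sc c lenc)
      (trans (cong (_+ weight c) ∣P∣≡) (sym (∣extend∣-Scattered sc′ c (trans lenc len)))))

module Profiles {n m : ℕ} (S : Fin n → Subset m) where

  #⊇ : Subset m → ℕ
  #⊇ I = count (λ x → I ⊆ᵇ S x)

  Harmonic : Set
  Harmonic = ∀ I J → runDecomposition I ≡ runDecomposition J → #⊇ I ≡ #⊇ J

  #⊇-within : Subset n → Subset m → ℕ
  #⊇-within W I = count (λ x → lookup W x ∧ (I ⊆ᵇ S x))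

  #traced : Subset m → List (Fin m) → (List Bool → Bool) → ℕ
  #traced P Q φ = count (λ x → (P ⊆ᵇ S x) ∧ φ (trace (S x) Q))

  private
    #avoiding : Subset m → Fin m → List (Fin m) → (List Bool → Bool) → ℕ
    #avoiding P q Q ψ = count (λ x → not (lookup (S x) q) ∧ ((P ⊆ᵇ S x) ∧ ψ (trace (S x) Q)))

    containing : ∀ (P : Subset m) q s (f : Bool → Bool) →
      lookup s q ∧ ((P ⊆ᵇ s) ∧ f (lookup s q)) ≡ (P ∪ ⁅ q ⁆ ⊆ᵇ s) ∧ f true
    containing P q s f = trans (pick (lookup s q)) (cong (_∧ f true) (sym (∪⁅⁆-⊆ᵇ P q s)))
      where
      pick : ∀ b → b ∧ ((P ⊆ᵇ s) ∧ f b) ≡ ((P ⊆ᵇ s) ∧ b) ∧ f true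
      pick true  rewrite ∧-identityʳ (P ⊆ᵇ s) = refl
      pick false rewrite ∧-zeroʳ (P ⊆ᵇ s)     = refl

    avoiding : ∀ b a (f : Bool → Bool) → not b ∧ (a ∧ f b) ≡ not b ∧ (a ∧ f false)
    avoiding true  a f = refl
    avoiding false a f = refl

    #traced-∷ : ∀ P q Q φ → #traced P (q ∷ Q) φ ≡
      #traced (P ∪ ⁅ q ⁆) Q (λ w → φ (true ∷ w)) + #avoiding P q Q (λ w → φ (false ∷ w))
    #traced-∷ P q Q φ = trans (count-split (λ x → lookup (S x) q) _) (cong₂ _+_
      (count-cong λ x → containing P q (S x) (λ b → φ (b ∷ trace (S x) Q)))
      (count-cong λ x → avoiding (lookup (S x) q) (P ⊆ᵇ S x) (λ b → φ (b ∷ trace (S x) Q))))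

    #traced-split : ∀ P q Q ψ → #traced P Q ψ ≡ #traced (P ∪ ⁅ q ⁆) Q ψ + #avoiding P q Q ψ
    #traced-split P q Q ψ = trans (count-split (λ x → lookup (S x) q) _) (cong (_+ #avoiding P q Q ψ)
      (count-cong λ x → containing P q (S x) (λ _ → ψ (trace (S x) Q))))

  -- Inclusion–exclusion over the entries of Q.
  #traced-cong : ∀ P P′ Q Q′ → length Q ≡ length Q′ →
    (∀ c → length c ≡ length Q → #⊇ (extend Q c P) ≡ #⊇ (extend Q′ c P′)) →
    ∀ φ → #traced P Q φ ≡ #traced P′ Q′ φ
  #traced-cong P P′ [] [] _ #⊇≡ φ with φ []
  ... | true  = trans (count-cong λ x → ∧-identityʳ (P ⊆ᵇ S x))
                      (trans (#⊇≡ [] refl) (count-cong λ x → sym (∧-identityʳ (P′ ⊆ᵇ S x))))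
  ... | false = trans (count-cong λ x → ∧-zeroʳ (P ⊆ᵇ S x)) (count-cong λ x → sym (∧-zeroʳ (P′ ⊆ᵇ S x)))
  #traced-cong P P′ (q ∷ Q) (q′ ∷ Q′) len #⊇≡ φ = begin
    #traced P (q ∷ Q) φ                          ≡⟨ #traced-∷ P q Q φ ⟩
    #traced (P ∪ ⁅ q ⁆) Q φ₁ + #avoiding P q Q φ₀ ≡⟨ cong₂ _+_ (IH-with φ₁) avoiding≡ ⟩
    #traced (P′ ∪ ⁅ q′ ⁆) Q′ φ₁ + #avoiding P′ q′ Q′ φ₀ ≡⟨ #traced-∷ P′ q′ Q′ φ ⟨
    #traced P′ (q′ ∷ Q′) φ                       ∎
    where
    open ≡-Reasoning
    φ₀ φ₁ : List Bool → Bool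
    φ₀ w = φ (false ∷ w)
    φ₁ w = φ (true ∷ w)
    len′ = suc-injective len
    IH-with : ∀ ψ → #traced (P ∪ ⁅ q ⁆) Q ψ ≡ #traced (P′ ∪ ⁅ q′ ⁆) Q′ ψ
    IH-with = #traced-cong (P ∪ ⁅ q ⁆) (P′ ∪ ⁅ q′ ⁆) Q Q′ len′ (λ c l → #⊇≡ (true ∷ c) (cong suc l))
    IH-without : #traced P Q φ₀ ≡ #traced P′ Q′ φ₀
    IH-without = #traced-cong P P′ Q Q′ len′ (λ c l → #⊇≡ (false ∷ c) (cong suc l)) φ₀
    avoiding≡ : #avoiding P q Q φ₀ ≡ #avoiding P′ q′ Q′ φ₀
    avoiding≡ = +-cancelˡ-≡ (#traced (P ∪ ⁅ q ⁆) Q φ₀) _ _ (begin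
      #traced (P ∪ ⁅ q ⁆) Q φ₀ + #avoiding P q Q φ₀      ≡⟨ #traced-split P q Q φ₀ ⟨
      #traced P Q φ₀                                    ≡⟨ IH-without ⟩
      #traced P′ Q′ φ₀                                  ≡⟨ #traced-split P′ q′ Q′ φ₀ ⟩
      #traced (P′ ∪ ⁅ q′ ⁆) Q′ φ₀ + #avoiding P′ q′ Q′ φ₀ ≡⟨ cong (_+ #avoiding P′ q′ Q′ φ₀) (IH-with φ₀) ⟨
      #traced (P ∪ ⁅ q ⁆) Q φ₀ + #avoiding P′ q′ Q′ φ₀   ∎)

  binomial≤count : ∀ (ψ : Fin n → Bool) Q k r → length Q ≡ k + r →
    (∀ v → length v ≡ length Q → weight v ≡ k → ∃ λ x → ψ x ≡ true × trace (S x) Q ≡ v) →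
    binomial k r ≤ count ψ
  binomial≤count ψ Q zero r len realised =
    let x , ψx , _ = realised (List.replicate (length Q) false) (length-replicate (length Q))
                       (weight-replicate-false (length Q))
    in count-positive ψ x ψx
  binomial≤count ψ Q (suc k) zero len realised =
    let x , ψx , _ = realised (List.replicate (length Q) true) (length-replicate (length Q))
                       (trans (weight-replicate-true (length Q)) (trans len (+-identityʳ (suc k))))
    in count-positive ψ x ψx
  binomial≤count ψ (q ∷ Q) (suc k) (suc r) len realised = begin
    binomial k (suc r) + binomial (suc k) r
      ≤⟨ +-mono-≤ (binomial≤count ψ₁ Q k (suc r) (suc-injective len) realised₁)
                  (binomial≤count ψ₀ Q (suc k) r (trans (suc-injective len) (+-suc k r)) realised₀) ⟩
    count ψ₁ + count ψ₀  ≡⟨ count-split (λ x → lookup (S x) q) ψ ⟨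
    count ψ              ∎
    where
    open ≤-Reasoning
    ψ₀ ψ₁ : Fin n → Bool
    ψ₁ x = lookup (S x) q ∧ ψ x
    ψ₀ x = not (lookup (S x) q) ∧ ψ x
    realised₁ : ∀ v → length v ≡ length Q → weight v ≡ k → ∃ λ x → ψ₁ x ≡ true × trace (S x) Q ≡ v
    realised₁ v lenv wtv =
      let x , ψx , tr = realised (true ∷ v) (cong suc lenv) (cong suc wtv)
      in x , ∧-intro (∷-injectiveˡ tr) ψx , ∷-injectiveʳ tr
    realised₀ : ∀ v → length v ≡ length Q → weight v ≡ suc k → ∃ λ x → ψ₀ x ≡ true × trace (S x) Q ≡ v
    realised₀ v lenv wtv =
      let x , ψx , tr = realised (false ∷ v) (cong suc lenv) wtv
      in x , ∧-intro (cong not (∷-injectiveˡ tr)) ψx , ∷-injectiveʳ tr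

-- Harmonic families of profiles

module HarmonicProfiles {n m : ℕ} (S : Fin n → Subset m) (harmonic : Profiles.Harmonic S) where
  open Profiles S

  #traced-Scattered : ∀ {I J P P′ Q Q′} → runDecomposition I ≡ runDecomposition J →
    Scattered I P Q → Scattered J P′ Q′ → ∣ P ∣ ≡ ∣ P′ ∣ → length Q ≡ length Q′ →
    ∀ φ → #traced (I ∪ P) Q φ ≡ #traced (J ∪ P′) Q′ φ
  #traced-Scattered {I} {J} {P} {P′} {Q} {Q′} I≈J sc sc′ ∣P∣≡ len =
    #traced-cong (I ∪ P) (J ∪ P′) Q Q′ len λ c lenc →
      harmonic (extend Q c (I ∪ P)) (extend Q′ c (J ∪ P′))
        (runDecomposition-extend I≈J sc sc′ ∣P∣≡ len c lenc)

  private
    ∅∪∅⊆ᵇ : ∀ (s : Subset m) → ∅ ∪ ∅ ⊆ᵇ s ≡ true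
    ∅∪∅⊆ᵇ s = subst (λ P → P ⊆ᵇ s ≡ true) (sym (∪-identityʳ ∅)) (∅⊆ᵇ s)

    ≡⇒≡ᵇ-true : ∀ {a b} → a ≡ b → (a ≡ᵇ b) ≡ true
    ≡⇒≡ᵇ-true {a} {b} a≡b = Equivalence.to T-≡ (≡⇒≡ᵇ a b a≡b)

    ≡ᵇ-true⇒≡ : ∀ {a b} → (a ≡ᵇ b) ≡ true → a ≡ b
    ≡ᵇ-true⇒≡ {a} {b} a≡ᵇb = ≡ᵇ⇒≡ a b (Equivalence.from T-≡ a≡ᵇb)

  ∩-size-transfer : ∀ {D D′ : Subset m} x {j} → nonconsecutive D ≡ true → nonconsecutive D′ ≡ true →
    ∣ D ∣ ≡ ∣ D′ ∣ → ∣ S x ∩ D ∣ ≡ j → ∃ λ y → ∣ S y ∩ D′ ∣ ≡ j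
  ∩-size-transfer {D} {D′} x {j} ncD ncD′ ∣D∣≡∣D′∣ ∣Sx∩D∣ =
    y , trans (sym (weight-trace-elements (S y) D′)) (≡ᵇ-true⇒≡ (∧-conicalʳ _ _ traced))
    where
    hasWeight : List Bool → Bool
    hasWeight w = weight w ≡ᵇ j
    #≡ : #traced (∅ ∪ ∅) (elements D) hasWeight ≡ #traced (∅ ∪ ∅) (elements D′) hasWeight
    #≡ = #traced-Scattered refl
           (elements-Scattered ∅ D ncD (⊆ᵇ-farFrom-∅ D)) (elements-Scattered ∅ D′ ncD′ (⊆ᵇ-farFrom-∅ D′))
           refl (trans (length-elements D) (trans ∣D∣≡∣D′∣ (sym (length-elements D′)))) hasWeight
    positive : 1 ≤ #traced (∅ ∪ ∅) (elements D) hasWeight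
    positive = count-positive _ x
      (∧-intro (∅∪∅⊆ᵇ (S x)) (≡⇒≡ᵇ-true (trans (weight-trace-elements (S x) D) ∣Sx∩D∣)))
    witness = count-witness _ (subst (1 ≤_) #≡ positive)
    y = proj₁ witness
    traced = proj₂ witness

  everyTraceRealised : ∀ (E : Subset m) → nonconsecutive E ≡ true → ∀ y v →
    length v ≡ length (elements E) → weight v ≡ weight (trace (S y) (elements E)) →
    ∃ λ x → trace (S x) (elements E) ≡ v
  everyTraceRealised E ncE y v lenv wtv =
    x , trace-determined Q v ∅ (S x) lenv
          (subst (λ P → P ⊆ᵇ S x ≡ true) (∪-identityˡ (extend Q v ∅)) (∧-conicalˡ _ _ found)) (∧-conicalʳ _ _ found)
    where
    Q = elements E
    u = trace (S y) Q
    lenu : length u ≡ length Q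
    lenu = length-map (lookup (S y)) Q
    -- Profiles with trace w on Q are those containing the selected entries and avoiding the others.
    scattered : ∀ w → Scattered ∅ (extend Q w ∅) (unselected Q w)
    scattered w = record
      { hull = E ; hull-nonconsecutive = ncE ; hull-farFrom = ⊆ᵇ-farFrom-∅ E
      ; base⊆hull = extend-⊆ᵇ Q w ∅ E (∅⊆ᵇ E) (elements-∈ E)
      ; entries∈hull = unselected-All Q w (elements-∈ E)
      ; entries-unique = unselected-unique Q w (elements-unique E)
      ; entries∉base = unselected-∉-extend Q w ∅ (elements-unique E) (∉∅ Q) }
    ∣extend∣≡weight : ∀ w → length w ≡ length Q → ∣ extend Q w ∅ ∣ ≡ weight w
    ∣extend∣≡weight w lenw =
      trans (∣extend∣ Q w ∅ (elements-unique E) (∉∅ Q) lenw) (cong (_+ weight w) (∣⊥∣≡0 m))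
    #≡ : #traced (∅ ∪ extend Q v ∅) (unselected Q v) (all not)
       ≡ #traced (∅ ∪ extend Q u ∅) (unselected Q u) (all not)
    #≡ = #traced-Scattered refl (scattered v) (scattered u)
      (trans (∣extend∣≡weight v lenv) (trans wtv (sym (∣extend∣≡weight u lenu))))
      (+-cancelʳ-≡ (weight v) _ _ (trans (length-unselected Q v lenv)
        (trans (sym (length-unselected Q u lenu)) (cong (length (unselected Q u) +_) (sym wtv)))))
      (all not)
    positive : 1 ≤ #traced (∅ ∪ extend Q u ∅) (unselected Q u) (all not)
    positive = count-positive _ y (∧-intro
      (trans (cong (_⊆ᵇ S y) (∪-identityˡ (extend Q u ∅))) (trans (extend-trace-⊆ᵇ Q ∅ (S y)) (∅⊆ᵇ (S y))))
      (none-unselected-trace Q (S y)))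
    witness = count-witness _ (subst (1 ≤_) (sym #≡) positive)
    x = proj₁ witness
    found = proj₂ witness

  binomial≤n : ∀ (E : Subset m) → nonconsecutive E ≡ true → ∀ y → binomial ∣ S y ∩ E ∣ ∣ ∁ (S y) ∩ E ∣ ≤ n
  binomial≤n E ncE y = ≤-trans
    (binomial≤count (λ _ → true) (elements E) ∣ S y ∩ E ∣ ∣ ∁ (S y) ∩ E ∣
      (trans (length-elements E) (∣∣-split (S y) E))
      λ v lenv wtv →
        let x , tr = everyTraceRealised E ncE y v lenv (trans wtv (sym (weight-trace-elements (S y) E)))
        in x , refl , tr)
    (count≤n _)

  profile-on-both-sides : ∀ (E : Subset m) → nonconsecutive E ≡ true → 6 ≤ ∣ E ∣ → ∀ x → BalancedSextet (S x) →
    ∃ λ y → 3 ≤ ∣ S y ∩ E ∣ × 3 ≤ ∣ ∁ (S y) ∩ E ∣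
  profile-on-both-sides E ncE 6≤∣E∣ x (D , ncD , ∣Sx∩D∣ , ∣∁Sx∩D∣) =
    let y , ∣Sy∩E₆∣ = ∩-size-transfer x ncD ncE₆ ∣D∣≡∣E₆∣ ∣Sx∩D∣
        ∣∁Sy∩E₆∣ = +-cancelˡ-≡ 3 _ _ (trans (cong (_+ ∣ ∁ (S y) ∩ E₆ ∣) (sym ∣Sy∩E₆∣))
                     (trans (sym (∣∣-split (S y) E₆)) ∣E₆∣≡6))
    in y , grow (S y) ∣Sy∩E₆∣ , grow (∁ (S y)) ∣∁Sy∩E₆∣
    where
    E₆ = takeFirst 6 E
    ncE₆ = nonconsecutive-⊆ᵇ E₆ E (takeFirst-⊆ᵇ 6 E) ncE
    ∣E₆∣≡6 = ∣takeFirst∣ 6 E 6≤∣E∣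
    ∣D∣≡∣E₆∣ : ∣ D ∣ ≡ ∣ E₆ ∣
    ∣D∣≡∣E₆∣ = trans (∣∣-split (S x) D) (trans (cong₂ _+_ ∣Sx∩D∣ ∣∁Sx∩D∣) (sym ∣E₆∣≡6))
    grow : ∀ s → ∣ s ∩ E₆ ∣ ≡ 3 → 3 ≤ ∣ s ∩ E ∣
    grow s ∣s∩E₆∣ = ≤-trans (≤-reflexive (sym ∣s∩E₆∣))
      (∣∣-mono-⊆ᵇ (s ∩ E₆) (s ∩ E) (∩-monoʳ-⊆ᵇ s E₆ E (takeFirst-⊆ᵇ 6 E)))

  twoSided⇒m*[m∸2]≤n : 51 ≤ m → ∀ x → NonconsecutiveSubset 3 (S x) → NonconsecutiveSubset 3 (∁ (S x)) →
    m * (m ∸ 2) ≤ n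
  twoSided⇒m*[m∸2]≤n 51≤m x inside outside =
    let y , 3≤k , 3≤r = profile-on-both-sides E ncE 6≤∣E∣ x sextet
        m≤2∣E∣ = subst (λ e → m ≤ e + e) (∣∣-split (S y) E) (proj₁ (∣alternating∣ m))
    in ≤-trans (m*[m∸2]≤binomial m ∣ S y ∩ E ∣ ∣ ∁ (S y) ∩ E ∣ 51≤m m≤2∣E∣ 3≤k 3≤r) (binomial≤n E ncE y)
    where
    E = alternating true m
    ncE = alternating-nonconsecutiveAfter true m false (λ ())
    6≤∣E∣ : 6 ≤ ∣ E ∣
    6≤∣E∣ = +-self-cancel-≤ (≤-trans (m≤m+n 12 39) (≤-trans 51≤m (proj₁ (∣alternating∣ m))))
    sextet = balancedSextet (S x) (≤-trans (m≤m+n 29 22) 51≤m) inside outside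

module Dichotomy {n m : ℕ} (S : Fin n → Subset m) (harmonic : Profiles.Harmonic S)
  (51≤m : 51 ≤ m) (n<m*[m∸2] : n < m * (m ∸ 2)) where
  open Profiles S
  open HarmonicProfiles S harmonic

  lean : Fin n → Bool
  lean x = does (¬? (nonconsecutiveSubset? 3 (S x)))

  Lean : Subset n
  Lean = tabulate lean

  Lean⇒¬triple : ∀ x → lookup Lean x ≡ true → ¬ NonconsecutiveSubset 3 (S x)
  Lean⇒¬triple x x∈Lean rewrite lookup∘tabulate lean x with nonconsecutiveSubset? 3 (S x)
  ... | no ¬triple = ¬triple

  ∁Lean⇒triple : ∀ x → lookup (∁ Lean) x ≡ true → NonconsecutiveSubset 3 (S x)
  ∁Lean⇒triple x x∈∁Lean rewrite lookup-map x not Lean | lookup∘tabulate lean x with nonconsecutiveSubset? 3 (S x)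
  ... | yes triple = triple

  ∁Lean⇒¬cotriple : ∀ x → lookup (∁ Lean) x ≡ true → ¬ NonconsecutiveSubset 3 (∁ (S x))
  ∁Lean⇒¬cotriple x x∈∁Lean cotriple =
    <⇒≱ n<m*[m∸2] (twoSided⇒m*[m∸2]≤n 51≤m x (∁Lean⇒triple x x∈∁Lean) cotriple)

  -- On a nonconsecutive quintet X, either S x or its complement meets X in at least 3 points.
  Lean-by-quintet : ∀ (X : Subset m) → nonconsecutive X ≡ true → ∣ X ∣ ≡ 5 →
    ∀ x → lookup Lean x ≡ does (∣ S x ∩ X ∣ ≤? 2)
  Lean-by-quintet X ncX ∣X∣≡5 x with lookup Lean x in lean | ∣ S x ∩ X ∣ ≤? 2
  ... | true  | yes ∣∣≤2 = sym (dec-true (∣ S x ∩ X ∣ ≤? 2) ∣∣≤2)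
  ... | false | no  ∣∣≰2 = sym (dec-false (∣ S x ∩ X ∣ ≤? 2) ∣∣≰2)
  ... | true  | no  ∣∣≰2 = contradiction (nonconsecutiveSubset-∩ 3 (S x) X ncX (≰⇒> ∣∣≰2)) (Lean⇒¬triple x lean)
  ... | false | yes ∣∣≤2 = contradiction (nonconsecutiveSubset-∩ 3 (∁ (S x)) X ncX 3≤) (∁Lean⇒¬cotriple x ∁lean)
    where
    ∁lean : lookup (∁ Lean) x ≡ true
    ∁lean = trans (lookup-map x not Lean) (cong not lean)
    3≤ : 3 ≤ ∣ ∁ (S x) ∩ X ∣
    3≤ = +-cancelˡ-≤ 2 3 _ (begin
      5                               ≡⟨ ∣X∣≡5 ⟨
      ∣ X ∣                           ≡⟨ ∣∣-split (S x) X ⟩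
      ∣ S x ∩ X ∣ + ∣ ∁ (S x) ∩ X ∣   ≤⟨ +-monoˡ-≤ _ ∣∣≤2 ⟩
      2 + ∣ ∁ (S x) ∩ X ∣             ∎)
      where open ≤-Reasoning

  private
    #Lean⊇-traced : ∀ (X : Subset m) → nonconsecutive X ≡ true → ∣ X ∣ ≡ 5 → ∀ I →
      #⊇-within Lean I ≡ #traced I (elements X) (λ w → does (weight w ≤? 2))
    #Lean⊇-traced X ncX ∣X∣≡5 I = count-cong λ x → trans (∧-comm (lookup Lean x) (I ⊆ᵇ S x))
      (cong ((I ⊆ᵇ S x) ∧_) (trans (Lean-by-quintet X ncX ∣X∣≡5 x)
        (cong (λ a → does (a ≤? 2)) (sym (weight-trace-elements (S x) X)))))

    #Lean⊇-large : ∀ I → 6 ≤ ∣ I ∣ → #⊇-within Lean I ≡ 0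
    #Lean⊇-large I 6≤∣I∣ = count-zero _ λ x → lean-and-above x
      where
      lean-and-above : ∀ x → lookup Lean x ∧ (I ⊆ᵇ S x) ≡ false
      lean-and-above x with lookup Lean x in lean | I ⊆ᵇ S x in I⊆Sx
      ... | false | _     = refl
      ... | true  | false = refl
      ... | true  | true  =
        let T , T⊆I , ncT , ∣T∣ = greedy-nonconsecutiveSubset 3 I 6≤∣I∣
        in contradiction (T , ⊆ᵇ-trans T I (S x) T⊆I I⊆Sx , ncT , ∣T∣) (Lean⇒¬triple x lean)

    #Lean⊇-quintets : ∀ {I J} → runDecomposition I ≡ runDecomposition J →
      NonconsecutiveSubset 5 (farFrom I) → NonconsecutiveSubset 5 (farFrom J) → #⊇-within Lean I ≡ #⊇-within Lean J
    #Lean⊇-quintets {I} {J} I≈J (X , X⊆ , ncX , ∣X∣) (X′ , X′⊆ , ncX′ , ∣X′∣) = begin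
      #⊇-within Lean I                     ≡⟨ #Lean⊇-traced X ncX ∣X∣ I ⟩
      #traced I (elements X) light         ≡⟨ cong (λ P → #traced P (elements X) light) (∪-identityʳ I) ⟨
      #traced (I ∪ ∅) (elements X) light   ≡⟨ #traced-Scattered I≈J (elements-Scattered I X ncX X⊆)
                                                (elements-Scattered J X′ ncX′ X′⊆) refl length≡ light ⟩
      #traced (J ∪ ∅) (elements X′) light  ≡⟨ cong (λ P → #traced P (elements X′) light) (∪-identityʳ J) ⟩
      #traced J (elements X′) light        ≡⟨ #Lean⊇-traced X′ ncX′ ∣X′∣ J ⟨
      #⊇-within Lean J                     ∎
      where
      open ≡-Reasoning
      light : List Bool → Bool
      light w = does (weight w ≤? 2)
      length≡ = trans (length-elements X) (trans ∣X∣ (sym (trans (length-elements X′) ∣X′∣)))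

  #Lean⊇-harmonic : ∀ I J → runDecomposition I ≡ runDecomposition J → #⊇-within Lean I ≡ #⊇-within Lean J
  #Lean⊇-harmonic I J I≈J with 6 ≤? ∣ I ∣
  ... | yes 6≤∣I∣ = trans (#Lean⊇-large I 6≤∣I∣) (sym (#Lean⊇-large J (≤-trans 6≤∣I∣ (≤-reflexive ∣I∣≡∣J∣))))
    where ∣I∣≡∣J∣ = runDecomposition≡⇒∣∣≡ I J I≈J
  ... | no  6≰∣I∣ = #Lean⊇-quintets I≈J
    (farFrom-nonconsecutiveSubset I ∣I∣≤5 25≤m)
    (farFrom-nonconsecutiveSubset J (≤-trans (≤-reflexive (sym ∣I∣≡∣J∣)) ∣I∣≤5) 25≤m)
    where
    ∣I∣≡∣J∣ = runDecomposition≡⇒∣∣≡ I J I≈J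
    ∣I∣≤5 = ≤-pred (≰⇒> 6≰∣I∣)
    25≤m = ≤-trans (m≤m+n 25 26) 51≤m

  #∁Lean⊇-harmonic : ∀ I J → runDecomposition I ≡ runDecomposition J → #⊇-within (∁ Lean) I ≡ #⊇-within (∁ Lean) J
  #∁Lean⊇-harmonic I J I≈J = +-cancelˡ-≡ (#⊇-within Lean I) _ _ (begin
    #⊇-within Lean I + #⊇-within (∁ Lean) I   ≡⟨ #⊇-split I ⟨
    #⊇ I                                      ≡⟨ harmonic I J I≈J ⟩
    #⊇ J                                      ≡⟨ #⊇-split J ⟩
    #⊇-within Lean J + #⊇-within (∁ Lean) J   ≡⟨ cong (_+ #⊇-within (∁ Lean) J) (#Lean⊇-harmonic I J I≈J) ⟨
    #⊇-within Lean I + #⊇-within (∁ Lean) J   ∎)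
    where
    open ≡-Reasoning
    #⊇-split : ∀ I → #⊇ I ≡ #⊇-within Lean I + #⊇-within (∁ Lean) I
    #⊇-split I = trans (count-split (lookup Lean) (λ x → I ⊆ᵇ S x))
      (cong (#⊇-within Lean I +_) (count-cong λ x → cong (_∧ (I ⊆ᵇ S x)) (sym (lookup-map x not Lean))))

-- Set systems

profile : ∀ {n m} → (Fin m → Subset n) → Fin n → Subset m
profile A x = tabulate λ i → lookup (A i) x

allFin-⊆ᵇ : ∀ {k} (I : Subset k) (g : Fin k → Bool) → allFin (λ i → not (lookup I i) ∨ g i) ≡ I ⊆ᵇ tabulate g
allFin-⊆ᵇ []      g = refl
allFin-⊆ᵇ (b ∷ I) g = cong ((not b ∨ g zero) ∧_) (allFin-⊆ᵇ I (λ i → g (suc i)))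

module _ {n m} (W : Subset n) (B : Fin m → Subset n) (S : Fin n → Subset m)
  (agrees : ∀ x → lookup W x ≡ true → profile B x ≡ S x) where

  ∣interOn∣ : ∀ I → ∣ interOn W B I ∣ ≡ count (λ x → lookup W x ∧ (I ⊆ᵇ S x))
  ∣interOn∣ I = count-cong within
    where
    within : ∀ x → lookup W x ∧ allFin (λ i → not (lookup I i) ∨ lookup (B i) x) ≡ lookup W x ∧ (I ⊆ᵇ S x)
    within x with lookup W x in x∈W
    ... | true  = trans (allFin-⊆ᵇ I (λ i → lookup (B i) x)) (cong (I ⊆ᵇ_) (agrees x x∈W))
    ... | false = refl

  HarmonicOn-by-count : (∀ I J → runDecomposition I ≡ runDecomposition J →
      count (λ x → lookup W x ∧ (I ⊆ᵇ S x)) ≡ count (λ x → lookup W x ∧ (J ⊆ᵇ S x))) → HarmonicOn W B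
  HarmonicOn-by-count harmonic I J I≈J = trans (∣interOn∣ I) (trans (harmonic I J I≈J) (sym (∣interOn∣ J)))

  Empty-interOn : ∀ I → (∀ x → lookup W x ≡ true → I ⊆ᵇ S x ≡ true → ⊥) → Empty (interOn W B I)
  Empty-interOn I never (x , x∈) =
    never x x∈W (trans (cong (I ⊆ᵇ_) (sym (agrees x x∈W))) (trans (sym (allFin-⊆ᵇ I _)) (∧-conicalʳ _ _ inter)))
    where
    inter : lookup W x ∧ allFin (λ i → not (lookup I i) ∨ lookup (B i) x) ≡ true
    inter = trans (sym (lookup∘tabulate _ x)) ([]=⇒lookup x∈)
    x∈W = ∧-conicalˡ _ _ inter

lookup-─ : ∀ {k} (p q : Subset k) x → lookup (p ─ q) x ≡ lookup p x ∧ not (lookup q x)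
lookup-─ (a ∷ p) (true ∷ q)  zero    = sym (∧-zeroʳ a)
lookup-─ (a ∷ p) (false ∷ q) zero    = sym (∧-identityʳ a)
lookup-─ (a ∷ p) (b ∷ q)     (suc x) = lookup-─ p q x

profile-∩ : ∀ {n m} (A : Fin m → Subset n) W x → lookup W x ≡ true → profile (λ i → A i ∩ W) x ≡ profile A x
profile-∩ A W x x∈W = tabulate-cong λ i →
  trans (lookup-zipWith _∧_ x (A i) W) (trans (cong (lookup (A i) x ∧_) x∈W) (∧-identityʳ _))

profile-─ : ∀ {n m} (A : Fin m → Subset n) W x → lookup W x ≡ true → profile (λ i → W ─ A i) x ≡ ∁ (profile A x)
profile-─ A W x x∈W = trans
  (tabulate-cong λ i → trans (lookup-─ W (A i) x) (cong (_∧ not (lookup (A i) x)) x∈W))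
  (tabulate-∘ not (λ i → lookup (A i) x))

HarmonicOn-⊤⇒Harmonic : ∀ {n m} (A : Fin m → Subset n) → HarmonicOn ⊤ A → Profiles.Harmonic (profile A)
HarmonicOn-⊤⇒Harmonic A harmonic I J I≈J = begin
  count (λ x → I ⊆ᵇ profile A x)                 ≡⟨ #⊇-as-⊤ I ⟩
  count (λ x → lookup ⊤ x ∧ (I ⊆ᵇ profile A x))   ≡⟨ ∣interOn∣ ⊤ A (profile A) (λ _ _ → refl) I ⟨
  ∣ interOn ⊤ A I ∣                               ≡⟨ harmonic I J I≈J ⟩
  ∣ interOn ⊤ A J ∣                               ≡⟨ ∣interOn∣ ⊤ A (profile A) (λ _ _ → refl) J ⟩
  count (λ x → lookup ⊤ x ∧ (J ⊆ᵇ profile A x))   ≡⟨ #⊇-as-⊤ J ⟨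
  count (λ x → J ⊆ᵇ profile A x)                 ∎
  where
  open ≡-Reasoning
  #⊇-as-⊤ : ∀ I → count (λ x → I ⊆ᵇ profile A x) ≡ count (λ x → lookup ⊤ x ∧ (I ⊆ᵇ profile A x))
  #⊇-as-⊤ I = count-cong λ x → cong (_∧ (I ⊆ᵇ profile A x)) (sym (lookup-replicate x true))

lemma4p25 : ∀ {n m : ℕ} (A : Fin m → Subset n) →
    HarmonicOn ⊤ A → n < m * (m ∸ 2) → 51 ≤ m →
    ∃ λ (U₁ : Subset n) →
      HarmonicOn U₁ (λ i → A i ∩ U₁) ×
      HarmonicOn (∁ U₁) (λ i → A i ∩ ∁ U₁) ×
      (∀ (I : Subset m) → Nonconsecutive I → ∣ I ∣ ≡ 3 →
        Empty (interOn U₁ (λ i → A i ∩ U₁) I)) ×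
      (∀ (I : Subset m) → Nonconsecutive I → ∣ I ∣ ≡ 3 →
        Empty (interOn (∁ U₁) (λ i → ∁ U₁ ─ A i) I))
lemma4p25 A harmonic n<m*[m∸2] 51≤m =
  Lean ,
  HarmonicOn-by-count Lean (λ i → A i ∩ Lean) S (profile-∩ A Lean) #Lean⊇-harmonic ,
  HarmonicOn-by-count (∁ Lean) (λ i → A i ∩ ∁ Lean) S (profile-∩ A (∁ Lean)) #∁Lean⊇-harmonic ,
  (λ I nc ∣I∣≡3 → Empty-interOn Lean (λ i → A i ∩ Lean) S (profile-∩ A Lean) I
     λ x x∈ I⊆Sx → Lean⇒¬triple x x∈ (Nonconsecutive⇒NonconsecutiveSubset I nc ∣I∣≡3 I⊆Sx)) ,
  (λ I nc ∣I∣≡3 → Empty-interOn (∁ Lean) (λ i → ∁ Lean ─ A i) (λ x → ∁ (S x)) (profile-─ A (∁ Lean)) I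
     λ x x∈ I⊆∁Sx → ∁Lean⇒¬cotriple x x∈ (Nonconsecutive⇒NonconsecutiveSubset I nc ∣I∣≡3 I⊆∁Sx))
  where
  S = profile A
  open Dichotomy S (HarmonicOn-⊤⇒Harmonic A harmonic) 51≤m n<m*[m∸2]
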